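{- Let $\mathscr D=\{d_1,\ldots,d_n\}$ be a set of positive integers with $d_1>d_2>\cdots>d_n$. (a) Suppose $\sigma(\mathscr D)$ is even or $d_n$ is odd. Let $\mathbf s=d_1,\ldots,d_n$, and let \[ c=\max_{1\le k\le n-1}\left\lceil \frac{ -\Delta_{\mathbf s}(k)}{\min\{k,d_n\}}\right\rceil=\left\lceil \frac{ -\Delta_{\mathbf s}(k^{\star})}{\min\{k^{\star},d_n\}}\right\rceil, \] where $k^{\star}\in\{1,\ldots,n-1\}$ is an index attaining the maximum. Then there exists a nonnegative integer $C$ such that the sequence $\overline{\mathbf s}=d_1,\ldots,d_{n-1},(d_n)_{C+1}$ is graphic, and the least such $C$ is \[ C^{\star}=\begin{cases} c & \text{if } d_n \text{ and } \sigma(\mathscr D) \text{ are even};\\ c & \text{if } d_n \text{ is odd and } \sigma(\mathscr D)+cd_n \text{ is even};\\ c+1 & \text{if } d_n \text{ and } \sigma(\mathscr D)+cd_n \text{ are odd}.\end{cases} \] Moreover, for $C=C^{\star}$ the sequence $\overline{\mathbf s}$ satisfies $\Delta_{\overline{\mathbf s}}(k^{\star})<2d_n$. (b) Suppose $\sigma(\mathscr D)$ is odd and $d_n$ is even. Let $r=\max\{i: d_i \text{ is odd}\}$ and let $\mathbf s=d_1,\ldots,d_{r-1},(d_r)_2,d_{r+1},\ldots,d_n$. Then there exists a nonnegative integer $C$ such that the sequence $\overline{\mathbf s}=d_1,\ldots,d_{r-1},(d_r)_2,d_{r+1},\ldots,d_{n-1},(d_n)_{C+1}$ (obtained by appending $C$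 copies of $d_n$ to $\mathbf s$) is graphic, and the least such $C$ is \[ C^{\star}=\max_{1\le k\le n}\left\lceil \frac{ -\Delta_{\mathbf s}(k)}{\min\{k,d_n\}}\right\rceil=\left\lceil \frac{ -\Delta_{\mathbf s}(k^{\star})}{\min\{k^{\star},d_n\}}\right\rceil, \] where $k^{\star}\in\{1,\ldots,n\}$ attains the maximum. Moreover, for $C=C^{\star}$ the sequence $\overline{\mathbf s}$ satisfies $\Delta_{\overline{\mathbf s}}(k^{\star})<d_n$.
   Context: All graphs are finite and simple. A nonincreasing sequence $a_1,\ldots,a_p$ of nonnegative integers is graphic if there is a simple graph with vertices $v_1,\ldots,v_p$ such that $\deg v_k=a_k$ for each $k$. The notation $(d)_m$ denotes $m$ consecutive occurrences of the integer $d$ in a sequence. For a set $S$ of integers, $\sigma(S)$ is the sum of its elements; for a sequence $\mathbf s$, $\sigma(\mathbf s)$ is the sum of its terms. For a sequence $\mathbf s=a_1,\ldots,a_p$ and $1\le k\le p$, define \[ \Delta_{\mathbf s}(k)=k(k-1)+\sum_{i=k+1}^{p}\min\{k,a_i\}-\sum_{i=1}^{k}a_i. \] -}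

module Defs where

open import Data.Nat as ℕ using (ℕ; zero; suc; _⊓_)
open import Data.Integer as ℤ using (ℤ; +_; -_)
open import Data.Integer.DivMod using (_/ℕ_)
open import Data.Nat.ListAction using (sum)
open import Data.List using (List; map; upTo; take; drop; length; lookup)
open import Data.Fin using (Fin)
open import Data.List using (allFin)
open import Data.Bool using (Bool; true; false; if_then_else_)
open import Data.Product using (Σ; _×_)
open import Relation.Binary.PropositionalEquality using (_≡_)

range1 : ℕ → List ℕ
range1 m = map suc (upTo m)

degree : ∀ {p} → (Fin p → Fin p → Bool) → Fin p → ℕ
degree {p} adj i = sum (map (λ j → if adj i j then 1 else 0) (allFin p))

IsSimpleGraph : ∀ {p} → (Fin p → Fin p → Bool) → Set
IsSimpleGraph {p} adj = (∀ i j → adj i j ≡ adj j i) × (∀ i → adj i i ≡ false)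

Graphic : List ℕ → Set
Graphic s = Σ (Fin (length s) → Fin (length s) → Bool) λ adj →
  IsSimpleGraph adj × (∀ k → degree adj k ≡ lookup s k)

Δ : List ℕ → ℕ → ℤ
Δ s k = + (k ℕ.* (k ℕ.∸ 1) ℕ.+ sum (map (k ⊓_) (drop k s))) ℤ.- + sum (take k s)

-- ⌈ a / b ⌉ for b ≥ 1 (only ever used with b ≥ 1; value 0 at b = 0 is a dummy)
ceilDiv : ℤ → ℕ → ℤ
ceilDiv a zero = + 0
ceilDiv a (suc b) = - ((- a) /ℕ suc b)

module Submission where

-- A sequence is graphic iff its sum is even and Δ(k) ≥ 0 for every k (Erdős–Gallai); necessity is
-- double counting, sufficiency follows Choudum's induction. For a sorted sequence that is constant from
-- index K on, the inequalities for k ≤ K already imply the others. Appending C copies of the last term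
-- d_n raises Δ(k) by C · min(k, d_n) for every k up to the original length, so the inequalities hold
-- exactly when C ≥ ⌈−Δ(k) / min(k, d_n)⌉ for each such k, i.e. when C ≥ c; and c ≥ 0 since d_1 ≥ n
-- forces Δ(1) ≤ 0. What remains is parity: in (a) it decides between c and c + 1, in (b) duplicating
-- the odd term d_r fixes it. The bound on Δ at k⋆ is Δ(k⋆) + C · min(k⋆, d_n) < (C − c + 1) · min(k⋆, d_n).

open import Defs
open import Data.Nat as ℕ
  using (ℕ; zero; suc; _+_; _*_; _∸_; _≤_; _<_; _⊓_; _≟_; _≤?_; _<?_; z≤n; s≤s; s≤s⁻¹; pred)
open import Data.Nat.Properties
open import Data.Nat.Divisibility using (_∣_; _∣?_; divides; ∣1⇒≡1; ∣m+n∣m⇒∣n; ∣m∣n⇒∣m+n; ∣n⇒∣m*n)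
open import Data.Nat.Tactic.RingSolver using (solve-∀)
open import Data.Nat.ListAction using (sum)
open import Data.Nat.ListAction.Properties using (sum-++)
open import Data.Integer as ℤ using (ℤ; -_)
import Data.Integer.Properties as ℤP
import Data.Integer.Tactic.RingSolver as ℤ-Solver
open import Data.Integer.Divisibility using () renaming (_∣_ to _∣ℤ_)
open import Data.Integer.DivMod using (_/ℕ_; _%ℕ_; a≡a%ℕn+[a/ℕn]*n; n%ℕd<d)
open import Data.Bool using (Bool; true; false; if_then_else_; _∧_; _∨_; _xor_; not)
import Data.Bool.Properties as Boolₚ
open import Data.List
  using (List; []; _∷_; _++_; map; take; drop; length; replicate; lookup; upTo; applyUpTo; tabulate)
open import Data.List.Properties
  using (map-++; length-++; length-map; length-replicate; length-applyUpTo; length-drop;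
         upTo-∷ʳ; map-upTo; ++-assoc; take++drop≡id; take-all; map-tabulate)
open import Data.Fin as Fin using (Fin; toℕ; fromℕ<)
open import Data.Fin.Properties using (toℕ<n; toℕ-fromℕ<)
open import Data.Maybe as Maybe using (Maybe; just; nothing)
open import Data.Product using (Σ; _×_; _,_; proj₁; proj₂)
open import Data.Sum using (_⊎_; inj₁; inj₂; [_,_])
open import Data.Empty using (⊥-elim)
open import Function using (id; case_of_)
open import Relation.Nullary using (¬_; Dec; yes; no; does)
open import Relation.Nullary.Decidable using (⌊_⌋; ¬?; _×-dec_; dec-true; dec-false)
open import Relation.Binary.Definitions using (tri<; tri≈; tri>)
open import Relation.Binary.PropositionalEquality hiding ([_])

-- Finite sums

-- ∑ f a n = f (a + 1) + ⋯ + f (a + n): sequences are indexed from 1.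
∑ : (ℕ → ℕ) → ℕ → ℕ → ℕ
∑ f a zero    = 0
∑ f a (suc n) = f (suc a) + ∑ f (suc a) n

private
  ≤-+-suc : ∀ a n {i} → i ≤ suc a + n → i ≤ a + suc n
  ≤-+-suc a n {i} p = subst (i ≤_) (sym (+-suc a n)) p

  suc≤+-suc : ∀ a n → suc a ≤ a + suc n
  suc≤+-suc a n = ≤-+-suc a n (s≤s (m≤m+n a n))

∑-cong : ∀ f g a n → (∀ i → a < i → i ≤ a + n → f i ≡ g i) → ∑ f a n ≡ ∑ g a n
∑-cong f g a zero    h = refl
∑-cong f g a (suc n) h =
  cong₂ _+_ (h (suc a) ≤-refl (suc≤+-suc a n))
            (∑-cong f g (suc a) n (λ i p q → h i (<⇒≤ p) (≤-+-suc a n q)))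

∑-mono-≤ : ∀ f g a n → (∀ i → a < i → i ≤ a + n → f i ≤ g i) → ∑ f a n ≤ ∑ g a n
∑-mono-≤ f g a zero    h = z≤n
∑-mono-≤ f g a (suc n) h =
  +-mono-≤ (h (suc a) ≤-refl (suc≤+-suc a n))
           (∑-mono-≤ f g (suc a) n (λ i p q → h i (<⇒≤ p) (≤-+-suc a n q)))

∑-+ : ∀ f a m n → ∑ f a (m + n) ≡ ∑ f a m + ∑ f (a + m) n
∑-+ f a zero    n = cong (λ z → ∑ f z n) (sym (+-identityʳ a))
∑-+ f a (suc m) n = begin
  f (suc a) + ∑ f (suc a) (m + n)                       ≡⟨ cong (f (suc a) +_) (∑-+ f (suc a) m n) ⟩
  f (suc a) + (∑ f (suc a) m + ∑ f (suc a + m) n)       ≡⟨ sym (+-assoc (f (suc a)) _ _) ⟩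
  f (suc a) + ∑ f (suc a) m + ∑ f (suc a + m) n
    ≡⟨ cong (λ z → f (suc a) + ∑ f (suc a) m + ∑ f z n) (sym (+-suc a m)) ⟩
  f (suc a) + ∑ f (suc a) m + ∑ f (a + suc m) n         ∎
  where open ≡-Reasoning

∑-split : ∀ f {k p} → k ≤ p → ∑ f 0 p ≡ ∑ f 0 k + ∑ f k (p ∸ k)
∑-split f {k} k≤p = trans (cong (∑ f 0) (sym (m+[n∸m]≡n k≤p))) (∑-+ f 0 k _)

∑-suc : ∀ f a n → ∑ f a (suc n) ≡ ∑ f a n + f (suc (a + n))
∑-suc f a n = begin
  ∑ f a (suc n)                 ≡⟨ cong (∑ f a) (+-comm 1 n) ⟩
  ∑ f a (n + 1)                 ≡⟨ ∑-+ f a n 1 ⟩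
  ∑ f a n + (f (suc (a + n)) + 0) ≡⟨ cong (∑ f a n +_) (+-identityʳ _) ⟩
  ∑ f a n + f (suc (a + n))     ∎
  where open ≡-Reasoning

∑-distrib-+ : ∀ f g a n → ∑ (λ i → f i + g i) a n ≡ ∑ f a n + ∑ g a n
∑-distrib-+ f g a zero    = refl
∑-distrib-+ f g a (suc n) = begin
  f (suc a) + g (suc a) + ∑ (λ i → f i + g i) (suc a) n
    ≡⟨ cong (f (suc a) + g (suc a) +_) (∑-distrib-+ f g (suc a) n) ⟩
  f (suc a) + g (suc a) + (∑ f (suc a) n + ∑ g (suc a) n)
    ≡⟨ interchange (f (suc a)) (g (suc a)) _ _ ⟩
  f (suc a) + ∑ f (suc a) n + (g (suc a) + ∑ g (suc a) n) ∎
  where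
  open ≡-Reasoning
  interchange : ∀ x y z w → x + y + (z + w) ≡ x + z + (y + w)
  interchange = solve-∀

∑-const : ∀ c a n → ∑ (λ _ → c) a n ≡ n * c
∑-const c a zero    = refl
∑-const c a (suc n) = cong (c +_) (∑-const c (suc a) n)

∑-zero : ∀ a n → ∑ (λ _ → 0) a n ≡ 0
∑-zero a n = trans (∑-const 0 a n) (*-zeroʳ n)

∑-one : ∀ a n → ∑ (λ _ → 1) a n ≡ n
∑-one a n = trans (∑-const 1 a n) (*-identityʳ n)

∑-distribˡ-* : ∀ c f a n → ∑ (λ i → c * f i) a n ≡ c * ∑ f a n
∑-distribˡ-* c f a zero    = sym (*-zeroʳ c)
∑-distribˡ-* c f a (suc n) =
  trans (cong (c * f (suc a) +_) (∑-distribˡ-* c f (suc a) n)) (sym (*-distribˡ-+ c (f (suc a)) _))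

∑-shift : ∀ f a n → ∑ f (suc a) n ≡ ∑ (λ i → f (suc i)) a n
∑-shift f a zero    = refl
∑-shift f a (suc n) = cong (f (suc (suc a)) +_) (∑-shift f (suc a) n)

∑-swap : ∀ (B : ℕ → ℕ → ℕ) a n c m →
         ∑ (λ i → ∑ (B i) c m) a n ≡ ∑ (λ j → ∑ (λ i → B i j) a n) c m
∑-swap B a zero    c m = sym (trans (∑-cong _ (λ _ → 0) c m (λ _ _ _ → refl)) (∑-zero c m))
∑-swap B a (suc n) c m = begin
  ∑ (B (suc a)) c m + ∑ (λ i → ∑ (B i) c m) (suc a) n
    ≡⟨ cong (∑ (B (suc a)) c m +_) (∑-swap B (suc a) n c m) ⟩
  ∑ (B (suc a)) c m + ∑ (λ j → ∑ (λ i → B i j) (suc a) n) c m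
    ≡⟨ sym (∑-distrib-+ (B (suc a)) (λ j → ∑ (λ i → B i j) (suc a) n) c m) ⟩
  ∑ (λ j → B (suc a) j + ∑ (λ i → B i j) (suc a) n) c m ∎
  where open ≡-Reasoning

∑-update : ∀ g h a n y → (∀ j → ¬ j ≡ y → g j ≡ h j) → a < y → y ≤ a + n →
           ∑ g a n + h y ≡ ∑ h a n + g y
∑-update g h a zero    y e p q = ⊥-elim (<⇒≱ p (subst (y ≤_) (+-identityʳ a) q))
∑-update g h a (suc n) y e p q with suc a ≟ y
... | yes refl = begin
  g (suc a) + ∑ g (suc a) n + h (suc a)
    ≡⟨ cong (λ z → g (suc a) + z + h (suc a))
            (∑-cong g h (suc a) n (λ i r _ → e i (λ i≡ → <-irrefl (sym i≡) r))) ⟩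
  g (suc a) + ∑ h (suc a) n + h (suc a) ≡⟨ swap (g (suc a)) _ (h (suc a)) ⟩
  h (suc a) + ∑ h (suc a) n + g (suc a) ∎
  where
  open ≡-Reasoning
  swap : ∀ x y z → x + y + z ≡ z + y + x
  swap = solve-∀
... | no ne = begin
  g (suc a) + ∑ g (suc a) n + h y     ≡⟨ +-assoc (g (suc a)) _ _ ⟩
  g (suc a) + (∑ g (suc a) n + h y)
    ≡⟨ cong₂ _+_ (e (suc a) ne) (∑-update g h (suc a) n y e (≤∧≢⇒< p ne) (subst (y ≤_) (+-suc a n) q)) ⟩
  h (suc a) + (∑ h (suc a) n + g y)   ≡⟨ sym (+-assoc (h (suc a)) _ _) ⟩
  h (suc a) + ∑ h (suc a) n + g y     ∎
  where open ≡-Reasoning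

δ : ℕ → ℕ → ℕ
δ y j with j ≟ y
... | yes _ = 1
... | no _  = 0

δ-refl : ∀ y → δ y y ≡ 1
δ-refl y with y ≟ y
... | yes _   = refl
... | no y≢y  = ⊥-elim (y≢y refl)

δ-≢ : ∀ {y i} → ¬ i ≡ y → δ y i ≡ 0
δ-≢ {y} {i} i≢y with i ≟ y
... | yes i≡y = ⊥-elim (i≢y i≡y)
... | no _    = refl

∑-δ : ∀ a n y → a < y → y ≤ a + n → ∑ (δ y) a n ≡ 1
∑-δ a n y p q = begin
  ∑ (δ y) a n                   ≡⟨ sym (+-identityʳ _) ⟩
  ∑ (δ y) a n + 0               ≡⟨ ∑-update (δ y) (λ _ → 0) a n y (λ j → δ-≢) p q ⟩
  ∑ (λ _ → 0) a n + δ y y       ≡⟨ cong₂ _+_ (∑-zero a n) (δ-refl y) ⟩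
  1                             ∎
  where open ≡-Reasoning

∑-δ-outside : ∀ y a n → (∀ i → a < i → i ≤ a + n → ¬ i ≡ y) → ∑ (δ y) a n ≡ 0
∑-δ-outside y a n out = trans (∑-cong _ _ a n (λ i p q → δ-≢ (out i p q))) (∑-zero a n)

term≤∑ : ∀ f a n y → a < y → y ≤ a + n → f y ≤ ∑ f a n
term≤∑ f a n y p q = begin
  f y                       ≡⟨ sym (trans (cong (f y *_) (∑-δ a n y p q)) (*-identityʳ (f y))) ⟩
  f y * ∑ (δ y) a n         ≡⟨ sym (∑-distribˡ-* (f y) (δ y) a n) ⟩
  ∑ (λ j → f y * δ y j) a n ≤⟨ ∑-mono-≤ _ f a n (λ j _ _ → pick j) ⟩
  ∑ f a n                   ∎
  where
  open ≤-Reasoning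
  pick : ∀ j → f y * δ y j ≤ f j
  pick j with j ≟ y
  ... | yes refl = ≤-reflexive (*-identityʳ (f j))
  ... | no _     = subst (_≤ f j) (sym (*-zeroʳ (f y))) z≤n

-- Graphs on the vertices 1, …, p

bit : Bool → ℕ
bit true  = 1
bit false = 0

bit≤1 : ∀ b → bit b ≤ 1
bit≤1 true  = s≤s z≤n
bit≤1 false = z≤n

-- Graphs are adjacency predicates on all of ℕ; only the vertices 1, …, p are counted.
IsSimple : (ℕ → ℕ → Bool) → Set
IsSimple A = (∀ i j → A i j ≡ A j i) × (∀ i → A i i ≡ false)

adjacent⇒≢ : ∀ {A} → IsSimple A → ∀ {u v} → A u v ≡ true → ¬ v ≡ u
adjacent⇒≢ (_ , loopless) {u} uv refl = case trans (sym uv) (loopless u) of λ ()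

distinguishes⇒≢ : ∀ (P : ℕ → Bool) {v w} → P v ≡ false → P w ≡ true → ¬ v ≡ w
distinguishes⇒≢ P ¬Pv Pw refl = case trans (sym ¬Pv) Pw of λ ()

deg : ℕ → (ℕ → ℕ → Bool) → ℕ → ℕ
deg p A i = ∑ (λ j → bit (A i j)) 0 p

Realises : ℕ → (ℕ → ℕ → Bool) → (ℕ → ℕ) → Set
Realises p A f = ∀ i → 1 ≤ i → i ≤ p → deg p A i ≡ f i

GraphicOn : ℕ → (ℕ → ℕ) → Set
GraphicOn p f = Σ (ℕ → ℕ → Bool) λ A → IsSimple A × Realises p A f

egLeft : (ℕ → ℕ) → ℕ → ℕ
egLeft f k = ∑ f 0 k

egRight : ℕ → (ℕ → ℕ) → ℕ → ℕ
egRight p f k = k * (k ∸ 1) + ∑ (λ i → k ⊓ f i) k (p ∸ k)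

ErdősGallai : ℕ → (ℕ → ℕ) → Set
ErdősGallai p f = ∀ k → 1 ≤ k → k ≤ p → egLeft f k ≤ egRight p f k

row≤k∸1 : ∀ A → IsSimple A → ∀ i k → 1 ≤ i → i ≤ k → ∑ (λ j → bit (A i j)) 0 k ≤ k ∸ 1
row≤k∸1 A (_ , loopless) i k 1≤i i≤k = m+n≤o⇒m≤o∸n _ (begin
  ∑ (λ j → bit (A i j)) 0 k + 1               ≡⟨ cong (∑ (λ j → bit (A i j)) 0 k +_) (sym (∑-δ 0 k i 1≤i i≤k)) ⟩
  ∑ (λ j → bit (A i j)) 0 k + ∑ (δ i) 0 k     ≡⟨ sym (∑-distrib-+ (λ j → bit (A i j)) (δ i) 0 k) ⟩
  ∑ (λ j → bit (A i j) + δ i j) 0 k           ≤⟨ ∑-mono-≤ _ (λ _ → 1) 0 k (λ j _ _ → atMostOne j) ⟩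
  ∑ (λ _ → 1) 0 k                             ≡⟨ ∑-one 0 k ⟩
  k                                           ∎)
  where
  open ≤-Reasoning
  atMostOne : ∀ j → bit (A i j) + δ i j ≤ 1
  atMostOne j with j ≟ i
  ... | yes refl = subst (λ b → bit b + 1 ≤ 1) (sym (loopless j)) ≤-refl
  ... | no _     = subst (_≤ 1) (sym (+-identityʳ _)) (bit≤1 (A i j))

-- Edges inside {1..k} are counted twice, edges from {1..k} to a later vertex j at most min(k, f j) times.
realises⇒ErdősGallai : ∀ p A f → IsSimple A → Realises p A f → ErdősGallai p f
realises⇒ErdősGallai p A f G@(sym-A , _) R k 1≤k k≤p = begin
  egLeft f k
    ≡⟨ ∑-cong f (deg p A) 0 k (λ i a b → sym (R i a (≤-trans b k≤p))) ⟩
  ∑ (deg p A) 0 k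
    ≡⟨ ∑-cong (deg p A) (λ i → ∑ (row i) 0 k + ∑ (row i) k (p ∸ k)) 0 k (λ i _ _ → ∑-split (row i) k≤p) ⟩
  ∑ (λ i → ∑ (row i) 0 k + ∑ (row i) k (p ∸ k)) 0 k
    ≡⟨ ∑-distrib-+ _ _ 0 k ⟩
  ∑ (λ i → ∑ (row i) 0 k) 0 k + ∑ (λ i → ∑ (row i) k (p ∸ k)) 0 k
    ≤⟨ +-mono-≤ inside outside ⟩
  egRight p f k ∎
  where
  open ≤-Reasoning
  row : ℕ → ℕ → ℕ
  row i j = bit (A i j)
  inside : ∑ (λ i → ∑ (row i) 0 k) 0 k ≤ k * (k ∸ 1)
  inside = begin
    ∑ (λ i → ∑ (row i) 0 k) 0 k ≤⟨ ∑-mono-≤ _ (λ _ → k ∸ 1) 0 k (λ i a b → row≤k∸1 A G i k a b) ⟩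
    ∑ (λ _ → k ∸ 1) 0 k         ≡⟨ ∑-const (k ∸ 1) 0 k ⟩
    k * (k ∸ 1)                 ∎
  column : ∀ j → k < j → j ≤ 0 + p → ∑ (λ i → row i j) 0 k ≤ k ⊓ f j
  column j k<j j≤p = ⊓-glb
    (begin
      ∑ (λ i → row i j) 0 k ≤⟨ ∑-mono-≤ _ (λ _ → 1) 0 k (λ i _ _ → bit≤1 (A i j)) ⟩
      ∑ (λ _ → 1) 0 k       ≡⟨ ∑-one 0 k ⟩
      k                     ∎)
    (begin
      ∑ (λ i → row i j) 0 k                 ≡⟨ ∑-cong _ (row j) 0 k (λ i _ _ → cong bit (sym-A i j)) ⟩
      ∑ (row j) 0 k                         ≤⟨ m≤m+n _ _ ⟩
      ∑ (row j) 0 k + ∑ (row j) k (p ∸ k)   ≡⟨ sym (∑-split (row j) k≤p) ⟩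
      deg p A j                             ≡⟨ R j (≤-trans 1≤k (<⇒≤ k<j)) j≤p ⟩
      f j                                   ∎)
  outside : ∑ (λ i → ∑ (row i) k (p ∸ k)) 0 k ≤ ∑ (λ i → k ⊓ f i) k (p ∸ k)
  outside = begin
    ∑ (λ i → ∑ (row i) k (p ∸ k)) 0 k       ≡⟨ ∑-swap row 0 k k (p ∸ k) ⟩
    ∑ (λ j → ∑ (λ i → row i j) 0 k) k (p ∸ k)
      ≤⟨ ∑-mono-≤ _ _ k (p ∸ k) (λ j a b → column j a (subst (j ≤_) (m+[n∸m]≡n k≤p) b)) ⟩
    ∑ (λ i → k ⊓ f i) k (p ∸ k)             ∎

doubleSum-even : ∀ (B : ℕ → ℕ → ℕ) → (∀ i j → B i j ≡ B j i) → (∀ i → B i i ≡ 0) →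
                 ∀ n → 2 ∣ ∑ (λ i → ∑ (B i) 0 n) 0 n
doubleSum-even B sym-B diag zero = divides 0 refl
doubleSum-even B sym-B diag (suc n) with doubleSum-even B sym-B diag n
... | divides q e = divides (q + X) (begin
  ∑ (λ i → ∑ (B i) 0 (suc n)) 0 (suc n)
    ≡⟨ ∑-cong _ (λ i → ∑ (B i) 0 n + B i (suc n)) 0 (suc n) (λ i _ _ → ∑-suc (B i) 0 n) ⟩
  ∑ (λ i → ∑ (B i) 0 n + B i (suc n)) 0 (suc n)
    ≡⟨ ∑-distrib-+ (λ i → ∑ (B i) 0 n) (λ i → B i (suc n)) 0 (suc n) ⟩
  ∑ (λ i → ∑ (B i) 0 n) 0 (suc n) + ∑ (λ i → B i (suc n)) 0 (suc n)
    ≡⟨ cong₂ _+_ (∑-suc _ 0 n) (∑-suc _ 0 n) ⟩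
  (∑ (λ i → ∑ (B i) 0 n) 0 n + X) + (∑ (λ i → B i (suc n)) 0 n + B (suc n) (suc n))
    ≡⟨ cong₂ (λ a b → (a + X) + (b + B (suc n) (suc n))) e
             (∑-cong _ (B (suc n)) 0 n (λ i _ _ → sym-B i (suc n))) ⟩
  (q * 2 + X) + (X + B (suc n) (suc n))
    ≡⟨ cong (λ z → (q * 2 + X) + (X + z)) (diag (suc n)) ⟩
  (q * 2 + X) + (X + 0)
    ≡⟨ regroup q X ⟩
  (q + X) * 2 ∎)
  where
  open ≡-Reasoning
  X = ∑ (B (suc n)) 0 n
  regroup : ∀ a b → (a * 2 + b) + (b + 0) ≡ (a + b) * 2
  regroup = solve-∀

realises⇒even : ∀ p A f → IsSimple A → Realises p A f → 2 ∣ ∑ f 0 p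
realises⇒even p A f (sym-A , loopless) R =
  subst (2 ∣_) (∑-cong _ f 0 p (λ i a b → R i a b))
        (doubleSum-even (λ i j → bit (A i j)) (λ i j → cong bit (sym-A i j)) (λ i → cong bit (loopless i)) p)

eqᵇ : ℕ → ℕ → Bool
eqᵇ i u = ⌊ i ≟ u ⌋

eqᵇ-refl : ∀ i → eqᵇ i i ≡ true
eqᵇ-refl i with i ≟ i
... | yes _   = refl
... | no i≢i  = ⊥-elim (i≢i refl)

eqᵇ-≢ : ∀ {i u} → ¬ i ≡ u → eqᵇ i u ≡ false
eqᵇ-≢ {i} {u} i≢u with i ≟ u
... | yes i≡u = ⊥-elim (i≢u i≡u)
... | no _    = refl

isEdge : ℕ → ℕ → ℕ → ℕ → Bool
isEdge u v i j = (eqᵇ i u ∧ eqᵇ j v) ∨ (eqᵇ i v ∧ eqᵇ j u)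

toggle : (ℕ → ℕ → Bool) → ℕ → ℕ → ℕ → ℕ → Bool
toggle A u v i j = A i j xor isEdge u v i j

xor-false : ∀ b → b xor false ≡ b
xor-false true  = refl
xor-false false = refl

xor-true : ∀ b → b xor true ≡ not b
xor-true true  = refl
xor-true false = refl

toggle-isSimple : ∀ A u v → ¬ u ≡ v → IsSimple A → IsSimple (toggle A u v)
toggle-isSimple A u v u≢v (sym-A , loopless) = symmetric , irreflexive
  where
  symmetric : ∀ i j → toggle A u v i j ≡ toggle A u v j i
  symmetric i j = cong₂ _xor_ (sym-A i j)
    (trans (cong₂ _∨_ (Boolₚ.∧-comm (eqᵇ i u) (eqᵇ j v)) (Boolₚ.∧-comm (eqᵇ i v) (eqᵇ j u)))
           (Boolₚ.∨-comm (eqᵇ j v ∧ eqᵇ i u) (eqᵇ j u ∧ eqᵇ i v)))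
  noLoop : ∀ i → isEdge u v i i ≡ false
  noLoop i with i ≟ u | i ≟ v
  ... | yes refl | yes refl = ⊥-elim (u≢v refl)
  ... | yes _    | no _     = refl
  ... | no _     | yes _    = refl
  ... | no _     | no _     = refl
  irreflexive : ∀ i → toggle A u v i i ≡ false
  irreflexive i = cong₂ _xor_ (loopless i) (noLoop i)

toggle-comm : ∀ A u v i j → toggle A u v i j ≡ toggle A v u i j
toggle-comm A u v i j = cong (A i j xor_) (Boolₚ.∨-comm (eqᵇ i u ∧ eqᵇ j v) (eqᵇ i v ∧ eqᵇ j u))

toggle-≢ : ∀ A u v x j → ¬ x ≡ u → ¬ x ≡ v → toggle A u v x j ≡ A x j
toggle-≢ A u v x j x≢u x≢v =
  trans (cong (A x j xor_) (cong₂ _∨_ (cong (_∧ eqᵇ j v) (eqᵇ-≢ x≢u)) (cong (_∧ eqᵇ j u) (eqᵇ-≢ x≢v))))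
        (xor-false _)

toggle-row : ∀ A u v j → ¬ u ≡ v → ¬ j ≡ v → toggle A u v u j ≡ A u j
toggle-row A u v j u≢v j≢v =
  trans (cong (A u j xor_) (cong₂ _∨_ (cong₂ _∧_ (eqᵇ-refl u) (eqᵇ-≢ j≢v)) (cong (_∧ eqᵇ j u) (eqᵇ-≢ u≢v))))
        (xor-false _)

toggle-uv : ∀ A u v → ¬ u ≡ v → toggle A u v u v ≡ not (A u v)
toggle-uv A u v u≢v =
  trans (cong (A u v xor_) (cong (_∨ (eqᵇ u v ∧ eqᵇ v u)) (cong₂ _∧_ (eqᵇ-refl u) (eqᵇ-refl v)))) (xor-true (A u v))

deg-toggle-≢ : ∀ p A u v x → ¬ x ≡ u → ¬ x ≡ v → deg p (toggle A u v) x ≡ deg p A x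
deg-toggle-≢ p A u v x x≢u x≢v = ∑-cong _ _ 0 p (λ j _ _ → cong bit (toggle-≢ A u v x j x≢u x≢v))

deg-toggle-comm : ∀ p A u v x → deg p (toggle A u v) x ≡ deg p (toggle A v u) x
deg-toggle-comm p A u v x = ∑-cong _ _ 0 p (λ j _ _ → cong bit (toggle-comm A u v x j))

deg-toggle : ∀ p A u v → ¬ u ≡ v → 1 ≤ v → v ≤ p →
             deg p (toggle A u v) u + bit (A u v) ≡ deg p A u + bit (not (A u v))
deg-toggle p A u v u≢v 1≤v v≤p =
  trans (∑-update (λ j → bit (toggle A u v u j)) (λ j → bit (A u j)) 0 p v
                  (λ j j≢v → cong bit (toggle-row A u v j u≢v j≢v)) 1≤v v≤p)
        (cong (λ b → deg p A u + bit b) (toggle-uv A u v u≢v))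

deg-toggle-add : ∀ p A u v → ¬ u ≡ v → 1 ≤ v → v ≤ p → A u v ≡ false →
                 deg p (toggle A u v) u ≡ suc (deg p A u)
deg-toggle-add p A u v u≢v 1≤v v≤p absent = begin
  deg p (toggle A u v) u                    ≡⟨ sym (+-identityʳ _) ⟩
  deg p (toggle A u v) u + bit false        ≡⟨ subst (λ b → deg p (toggle A u v) u + bit b ≡ deg p A u + bit (not b))
                                                     absent (deg-toggle p A u v u≢v 1≤v v≤p) ⟩
  deg p A u + 1                             ≡⟨ +-comm _ 1 ⟩
  suc (deg p A u)                           ∎
  where open ≡-Reasoning

deg-toggle-remove : ∀ p A u v → ¬ u ≡ v → 1 ≤ v → v ≤ p → A u v ≡ true →
                    suc (deg p (toggle A u v) u) ≡ deg p A u
deg-toggle-remove p A u v u≢v 1≤v v≤p present = begin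
  suc (deg p (toggle A u v) u)              ≡⟨ +-comm 1 _ ⟩
  deg p (toggle A u v) u + bit true         ≡⟨ subst (λ b → deg p (toggle A u v) u + bit b ≡ deg p A u + bit (not b))
                                                     present (deg-toggle p A u v u≢v 1≤v v≤p) ⟩
  deg p A u + 0                             ≡⟨ +-identityʳ _ ⟩
  deg p A u                                 ∎
  where open ≡-Reasoning

suc-deg-universal : ∀ p A t → IsSimple A → 1 ≤ t → t ≤ p →
                    (∀ i → 1 ≤ i → i ≤ p → ¬ i ≡ t → A t i ≡ true) → suc (deg p A t) ≡ p
suc-deg-universal p A t (_ , loopless) 1≤t t≤p adjacent = begin
  suc (deg p A t)                         ≡⟨ +-comm 1 _ ⟩
  deg p A t + 1                           ≡⟨ cong (deg p A t +_) (sym (∑-δ 0 p t 1≤t t≤p)) ⟩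
  deg p A t + ∑ (δ t) 0 p                 ≡⟨ sym (∑-distrib-+ (λ i → bit (A t i)) (δ t) 0 p) ⟩
  ∑ (λ i → bit (A t i) + δ t i) 0 p       ≡⟨ ∑-cong _ (λ _ → 1) 0 p exactlyOne ⟩
  ∑ (λ _ → 1) 0 p                         ≡⟨ ∑-one 0 p ⟩
  p                                       ∎
  where
  open ≡-Reasoning
  exactlyOne : ∀ i → 0 < i → i ≤ 0 + p → bit (A t i) + δ t i ≡ 1
  exactlyOne i 1≤i i≤p with i ≟ t
  ... | yes refl = cong (_+ 1) (cong bit (loopless i))
  ... | no i≢t   = cong (_+ 0) (cong bit (adjacent i 1≤i i≤p i≢t))

deg-mono : ∀ p A u v w → 1 ≤ w → w ≤ p → 1 ≤ v → v ≤ p →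
           (∀ j → 1 ≤ j → j ≤ p → bit (A u j) + δ w j ≤ bit (A v j) + δ v j) → deg p A u ≤ deg p A v
deg-mono p A u v w 1≤w w≤p 1≤v v≤p pointwise = +-cancelʳ-≤ 1 _ _ (begin
  deg p A u + 1                       ≡⟨ cong (deg p A u +_) (sym (∑-δ 0 p w 1≤w w≤p)) ⟩
  deg p A u + ∑ (δ w) 0 p             ≡⟨ sym (∑-distrib-+ (λ j → bit (A u j)) (δ w) 0 p) ⟩
  ∑ (λ j → bit (A u j) + δ w j) 0 p   ≤⟨ ∑-mono-≤ _ _ 0 p pointwise ⟩
  ∑ (λ j → bit (A v j) + δ v j) 0 p   ≡⟨ ∑-distrib-+ (λ j → bit (A v j)) (δ v) 0 p ⟩
  deg p A v + ∑ (δ v) 0 p             ≡⟨ cong (deg p A v +_) (∑-δ 0 p v 1≤v v≤p) ⟩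
  deg p A v + 1                       ∎)
  where open ≤-Reasoning

boundedSearch : (P : ℕ → Set) → (∀ i → Dec (P i)) → ∀ p →
                (Σ ℕ λ i → 1 ≤ i × i ≤ p × P i) ⊎ (∀ i → 1 ≤ i → i ≤ p → ¬ P i)
boundedSearch P P? zero = inj₂ (λ i 1≤i i≤0 _ → ⊥-elim (<⇒≱ 1≤i i≤0))
boundedSearch P P? (suc p) with boundedSearch P P? p
... | inj₁ (i , 1≤i , i≤p , Pi) = inj₁ (i , 1≤i , m≤n⇒m≤1+n i≤p , Pi)
... | inj₂ none with P? (suc p)
...   | yes Pp = inj₁ (suc p , s≤s z≤n , ≤-refl , Pp)
...   | no ¬Pp = inj₂ noneUpTo
  where
  noneUpTo : ∀ i → 1 ≤ i → i ≤ suc p → ¬ P i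
  noneUpTo i 1≤i i≤p with m≤n⇒m<n∨m≡n i≤p
  ... | inj₁ i<p  = none i 1≤i (s≤s⁻¹ i<p)
  ... | inj₂ refl = ¬Pp

-- Sufficiency of the Erdős–Gallai conditions

lower : (ℕ → ℕ) → ℕ → ℕ → ℕ
lower f y i = f i ∸ δ y i

lower-≢ : ∀ f {y i} → ¬ i ≡ y → lower f y i ≡ f i
lower-≢ f {y} {i} i≢y = cong (f i ∸_) (δ-≢ i≢y)

suc-lower : ∀ f y → 1 ≤ f y → suc (lower f y y) ≡ f y
suc-lower f y 1≤fy = trans (cong (λ z → suc (f y ∸ z)) (δ-refl y)) (m+[n∸m]≡n {1} 1≤fy)

lower-≤ : ∀ f y i → lower f y i ≤ f i
lower-≤ f y i = m∸n≤m (f i) (δ y i)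

∑-lower : ∀ f y a n → a < y → y ≤ a + n → 1 ≤ f y → ∑ f a n ≡ suc (∑ (lower f y) a n)
∑-lower f y a n a<y y≤a+n 1≤fy = +-cancelʳ-≡ (f y ∸ 1) _ _ (begin
  ∑ f a n + (f y ∸ 1)                    ≡⟨ cong (λ z → ∑ f a n + (f y ∸ z)) (sym (δ-refl y)) ⟩
  ∑ f a n + lower f y y                  ≡⟨ ∑-update f (lower f y) a n y (λ j j≢y → sym (lower-≢ f j≢y)) a<y y≤a+n ⟩
  ∑ (lower f y) a n + f y                ≡⟨ cong (∑ (lower f y) a n +_) (sym (m+[n∸m]≡n {1} 1≤fy)) ⟩
  ∑ (lower f y) a n + suc (f y ∸ 1)      ≡⟨ +-suc _ _ ⟩
  suc (∑ (lower f y) a n) + (f y ∸ 1)    ∎)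
  where open ≡-Reasoning

∑-lower-outside : ∀ f y a n → (∀ i → a < i → i ≤ a + n → ¬ i ≡ y) → ∑ (lower f y) a n ≡ ∑ f a n
∑-lower-outside f y a n out = ∑-cong _ _ a n (λ i p q → lower-≢ f (out i p q))

⊓-∸-+ : ∀ k x e → k ⊓ x ≤ k ⊓ (x ∸ e) + e
⊓-∸-+ k x e = subst (k ⊓ x ≤_) (sym (+-distribʳ-⊓ e k (x ∸ e)))
  (⊓-mono-≤ (m≤m+n k e) (subst (x ≤_) (+-comm e (x ∸ e)) (m≤n+m∸n x e)))

-- Raising the entries t < p by one, where entry p is minimal and entry t is less than p, preserves
-- realisability: either the edge tp can be added, or a 2-switch through a non-neighbour i of t and
-- a neighbour j of i that is not a neighbour of p frees room for it.
module Raise (p : ℕ) (f : ℕ → ℕ) (t : ℕ) (1≤t : 1 ≤ t) (t<p : t < p) (1≤ft : 1 ≤ f t) (1≤fp : 1 ≤ f p)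
             (fp-min : ∀ i → 1 ≤ i → i ≤ p → f p ≤ f i) (ft<p : f t < p) where

  f' : ℕ → ℕ
  f' = lower (lower f t) p

  private
    t≢p : ¬ t ≡ p
    t≢p t≡p = <-irrefl t≡p t<p

    p≢t : ¬ p ≡ t
    p≢t p≡t = t≢p (sym p≡t)

    t≤p : t ≤ p
    t≤p = <⇒≤ t<p

    1≤p : 1 ≤ p
    1≤p = ≤-trans 1≤t t≤p

  f'-≢ : ∀ x → ¬ x ≡ t → ¬ x ≡ p → f' x ≡ f x
  f'-≢ x x≢t x≢p = trans (lower-≢ (lower f t) x≢p) (lower-≢ f x≢t)

  suc-f'-t : suc (f' t) ≡ f t
  suc-f'-t = trans (cong suc (lower-≢ (lower f t) t≢p)) (suc-lower f t 1≤ft)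

  suc-f'-p : suc (f' p) ≡ f p
  suc-f'-p = trans (cong (λ z → suc (z ∸ δ p p)) (lower-≢ f p≢t)) (suc-lower f p 1≤fp)

  module _ (A : ℕ → ℕ → Bool) (G : IsSimple A) (R : Realises p A f') where

    private
      sym-A = proj₁ G
      loopless = proj₂ G

    realises-addEdge : A t p ≡ false → Realises p (toggle A t p) f
    realises-addEdge absent x 1≤x x≤p = at (x ≟ t) (x ≟ p)
      where
      open ≡-Reasoning
      at : Dec (x ≡ t) → Dec (x ≡ p) → deg p (toggle A t p) x ≡ f x
      at (yes refl) _ = begin
        deg p (toggle A t p) t    ≡⟨ deg-toggle-add p A t p t≢p 1≤p ≤-refl absent ⟩
        suc (deg p A t)           ≡⟨ cong suc (R t 1≤t t≤p) ⟩
        suc (f' t)                ≡⟨ suc-f'-t ⟩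
        f t                       ∎
      at (no _) (yes refl) = begin
        deg p (toggle A t p) p    ≡⟨ deg-toggle-comm p A t p p ⟩
        deg p (toggle A p t) p    ≡⟨ deg-toggle-add p A p t p≢t 1≤t t≤p (trans (sym-A p t) absent) ⟩
        suc (deg p A p)           ≡⟨ cong suc (R p 1≤p ≤-refl) ⟩
        suc (f' p)                ≡⟨ suc-f'-p ⟩
        f p                       ∎
      at (no x≢t) (no x≢p) = begin
        deg p (toggle A t p) x    ≡⟨ deg-toggle-≢ p A t p x x≢t x≢p ⟩
        deg p A x                 ≡⟨ R x 1≤x x≤p ⟩
        f' x                      ≡⟨ f'-≢ x x≢t x≢p ⟩
        f x                       ∎

    -- add the edges ti and pj, remove the edge ij
    switch : ℕ → ℕ → ℕ → ℕ → Bool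
    switch i j = toggle (toggle (toggle A t i) p j) i j

    switch-isSimple : ∀ i j → ¬ i ≡ t → ¬ j ≡ p → ¬ j ≡ i → IsSimple (switch i j)
    switch-isSimple i j i≢t j≢p j≢i =
      toggle-isSimple _ i j (≢-sym j≢i) (toggle-isSimple _ p j (≢-sym j≢p) (toggle-isSimple A t i (≢-sym i≢t) G))

    realises-switch : ∀ i j → 1 ≤ i → i ≤ p → 1 ≤ j → j ≤ p → ¬ i ≡ t → ¬ i ≡ p → ¬ j ≡ p →
                      A t i ≡ false → A i j ≡ true → A p j ≡ false → Realises p (switch i j) f
    realises-switch i j 1≤i i≤p 1≤j j≤p i≢t i≢p j≢p ¬ti ij ¬pj x 1≤x x≤p = at (x ≟ t) (x ≟ i) (x ≟ j) (x ≟ p)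
      where
      open ≡-Reasoning
      j≢i : ¬ j ≡ i
      j≢i = adjacent⇒≢ G ij
      j≢t : ¬ j ≡ t
      j≢t = ≢-sym (distinguishes⇒≢ (A i) (trans (sym-A i t) ¬ti) ij)
      A₁ = toggle A t i
      A₂ = toggle A₁ p j
      ¬A₁pj : A₁ p j ≡ false
      ¬A₁pj = trans (toggle-≢ A t i p j (≢-sym t≢p) (≢-sym i≢p)) ¬pj
      A₂ij : A₂ i j ≡ true
      A₂ij = trans (toggle-≢ A₁ p j i j i≢p (≢-sym j≢i))
                   (trans (toggle-comm A t i i j) (trans (toggle-row A i t j i≢t j≢t) ij))
      at : Dec (x ≡ t) → Dec (x ≡ i) → Dec (x ≡ j) → Dec (x ≡ p) → deg p (switch i j) x ≡ f x
      at (yes refl) _ _ _ = begin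
        deg p (switch i j) t    ≡⟨ deg-toggle-≢ p A₂ i j t (≢-sym i≢t) (≢-sym j≢t) ⟩
        deg p A₂ t              ≡⟨ deg-toggle-≢ p A₁ p j t t≢p (≢-sym j≢t) ⟩
        deg p A₁ t              ≡⟨ deg-toggle-add p A t i (≢-sym i≢t) 1≤i i≤p ¬ti ⟩
        suc (deg p A t)         ≡⟨ cong suc (R t 1≤t t≤p) ⟩
        suc (f' t)              ≡⟨ suc-f'-t ⟩
        f t                     ∎
      at (no _) (yes refl) _ _ = suc-injective (begin
        suc (deg p (switch i j) i) ≡⟨ deg-toggle-remove p A₂ i j (≢-sym j≢i) 1≤j j≤p A₂ij ⟩
        deg p A₂ i              ≡⟨ deg-toggle-≢ p A₁ p j i i≢p (≢-sym j≢i) ⟩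
        deg p A₁ i              ≡⟨ deg-toggle-comm p A t i i ⟩
        deg p (toggle A i t) i  ≡⟨ deg-toggle-add p A i t i≢t 1≤t t≤p (trans (sym-A i t) ¬ti) ⟩
        suc (deg p A i)         ≡⟨ cong suc (trans (R i 1≤i i≤p) (f'-≢ i i≢t i≢p)) ⟩
        suc (f i)               ∎)
      at (no _) (no _) (yes refl) _ = suc-injective (begin
        suc (deg p (switch i j) j) ≡⟨ cong suc (deg-toggle-comm p A₂ i j j) ⟩
        suc (deg p (toggle A₂ j i) j) ≡⟨ deg-toggle-remove p A₂ j i j≢i 1≤i i≤p (trans (sym-A₂ j i) A₂ij) ⟩
        deg p A₂ j              ≡⟨ deg-toggle-comm p A₁ p j j ⟩
        deg p (toggle A₁ j p) j ≡⟨ deg-toggle-add p A₁ j p j≢p 1≤p ≤-refl (trans (sym-A₁ j p) ¬A₁pj) ⟩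
        suc (deg p A₁ j)        ≡⟨ cong suc (deg-toggle-≢ p A t i j j≢t j≢i) ⟩
        suc (deg p A j)         ≡⟨ cong suc (trans (R j 1≤j j≤p) (f'-≢ j j≢t j≢p)) ⟩
        suc (f j)               ∎)
        where
        sym-A₁ = proj₁ (toggle-isSimple A t i (≢-sym i≢t) G)
        sym-A₂ = proj₁ (toggle-isSimple A₁ p j (≢-sym j≢p) (toggle-isSimple A t i (≢-sym i≢t) G))
      at (no _) (no _) (no _) (yes refl) = begin
        deg p (switch i j) p    ≡⟨ deg-toggle-≢ p A₂ i j p (≢-sym i≢p) (≢-sym j≢p) ⟩
        deg p A₂ p              ≡⟨ deg-toggle-add p A₁ p j (≢-sym j≢p) 1≤j j≤p ¬A₁pj ⟩
        suc (deg p A₁ p)        ≡⟨ cong suc (deg-toggle-≢ p A t i p p≢t (≢-sym i≢p)) ⟩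
        suc (deg p A p)         ≡⟨ cong suc (R p 1≤p ≤-refl) ⟩
        suc (f' p)              ≡⟨ suc-f'-p ⟩
        f p                     ∎
      at (no x≢t) (no x≢i) (no x≢j) (no x≢p) = begin
        deg p (switch i j) x    ≡⟨ deg-toggle-≢ p A₂ i j x x≢i x≢j ⟩
        deg p A₂ x              ≡⟨ deg-toggle-≢ p A₁ p j x x≢p x≢j ⟩
        deg p A₁ x              ≡⟨ deg-toggle-≢ p A t i x x≢t x≢i ⟩
        deg p A x               ≡⟨ R x 1≤x x≤p ⟩
        f' x                    ≡⟨ f'-≢ x x≢t x≢p ⟩
        f x                     ∎

    adjacentToAll⇒ft≡p : (∀ i → 1 ≤ i → i ≤ p → ¬ (¬ i ≡ t × A t i ≡ false)) → f t ≡ p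
    adjacentToAll⇒ft≡p none = begin
      f t              ≡⟨ sym suc-f'-t ⟩
      suc (f' t)       ≡⟨ cong suc (sym (R t 1≤t t≤p)) ⟩
      suc (deg p A t)  ≡⟨ suc-deg-universal p A t G 1≤t t≤p adjacent ⟩
      p                ∎
      where
      open ≡-Reasoning
      adjacent : ∀ i → 1 ≤ i → i ≤ p → ¬ i ≡ t → A t i ≡ true
      adjacent i 1≤i i≤p i≢t with A t i in ti
      ... | true  = refl
      ... | false = ⊥-elim (none i 1≤i i≤p (i≢t , ti))

    -- The neighbours of i lie among those of p and p itself, and t is a neighbour of p but not of i.
    dominated⇒fi<fp : ∀ i → 1 ≤ i → i ≤ p → ¬ i ≡ t → ¬ i ≡ p → A t i ≡ false → A t p ≡ true →
                      (∀ j → 1 ≤ j → j ≤ p → ¬ (A i j ≡ true × ¬ j ≡ p × A p j ≡ false)) → f i < f p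
    dominated⇒fi<fp i 1≤i i≤p i≢t i≢p ¬ti tp none = begin-strict
      f i         ≡⟨ sym (trans (R i 1≤i i≤p) (f'-≢ i i≢t i≢p)) ⟩
      deg p A i   ≤⟨ deg-mono p A i p t 1≤t t≤p 1≤p ≤-refl pointwise ⟩
      deg p A p   ≡⟨ R p 1≤p ≤-refl ⟩
      f' p        <⟨ ≤-reflexive suc-f'-p ⟩
      f p         ∎
      where
      open ≤-Reasoning
      pointwise : ∀ j → 1 ≤ j → j ≤ p → bit (A i j) + δ t j ≤ bit (A p j) + δ p j
      pointwise j 1≤j j≤p = compare (j ≟ t) (j ≟ p)
        where
        compare : Dec (j ≡ t) → Dec (j ≡ p) → bit (A i j) + δ t j ≤ bit (A p j) + δ p j
        compare (yes refl) _ = ≤-reflexive (trans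
          (cong₂ _+_ (cong bit (trans (sym-A i j) ¬ti)) (δ-refl j))
          (sym (cong₂ _+_ (cong bit (trans (sym-A p j) tp)) (δ-≢ t≢p))))
        compare (no j≢t) (yes refl) = subst₂ _≤_ (sym (cong (bit (A i j) +_) (δ-≢ j≢t)))
          (sym (cong₂ _+_ (cong bit (loopless j)) (δ-refl j))) (subst (_≤ 1) (sym (+-identityʳ _)) (bit≤1 (A i j)))
        compare (no j≢t) (no j≢p) = subst₂ _≤_ (sym (cong (bit (A i j) +_) (δ-≢ j≢t)))
          (sym (cong (bit (A p j) +_) (δ-≢ j≢p))) (+-monoˡ-≤ 0 bits)
          where
          bits : bit (A i j) ≤ bit (A p j)
          bits with A i j in ij
          ... | false = z≤n
          ... | true with A p j in pj
          ...   | true  = ≤-refl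
          ...   | false = ⊥-elim (none j 1≤j j≤p (ij , j≢p , pj))

  graphicOn-raise : GraphicOn p f' → GraphicOn p f
  graphicOn-raise (A , G , R) with A t p in tp
  ... | false = toggle A t p , toggle-isSimple A t p t≢p G , realises-addEdge A G R tp
  ... | true with boundedSearch (λ i → ¬ i ≡ t × A t i ≡ false) (λ i → ¬? (i ≟ t) ×-dec (A t i Boolₚ.≟ false)) p
  ...   | inj₂ none = ⊥-elim (<-irrefl (adjacentToAll⇒ft≡p A G R none) ft<p)
  ...   | inj₁ (i , 1≤i , i≤p , i≢t , ¬ti)
          with boundedSearch (λ j → A i j ≡ true × ¬ j ≡ p × A p j ≡ false)
                             (λ j → (A i j Boolₚ.≟ true) ×-dec (¬? (j ≟ p) ×-dec (A p j Boolₚ.≟ false))) p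
  ...     | inj₂ none = ⊥-elim (<⇒≱ (dominated⇒fi<fp A G R i 1≤i i≤p i≢t i≢p ¬ti tp none) (fp-min i 1≤i i≤p))
    where
    i≢p = distinguishes⇒≢ (A t) ¬ti tp
  ...     | inj₁ (j , 1≤j , j≤p , ij , j≢p , ¬pj) =
    switch A G R i j , switch-isSimple A G R i j i≢t j≢p (adjacent⇒≢ G ij) ,
    realises-switch A G R i j 1≤i i≤p 1≤j j≤p i≢t (distinguishes⇒≢ (A t) ¬ti tp) j≢p ¬ti ij ¬pj

Sorted : ℕ → (ℕ → ℕ) → Set
Sorted p f = ∀ i j → 1 ≤ i → i ≤ j → j ≤ p → f j ≤ f i

sorted-adjacent : ∀ p f → (∀ i → 1 ≤ i → i < p → f (suc i) ≤ f i) → Sorted p f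
sorted-adjacent p f step i j 1≤i i≤j j≤p =
  subst (λ z → f z ≤ f i) (m+[n∸m]≡n i≤j) (go (j ∸ i) (subst (_≤ p) (sym (m+[n∸m]≡n i≤j)) j≤p))
  where
  go : ∀ e → i + e ≤ p → f (i + e) ≤ f i
  go zero    _   = ≤-reflexive (cong f (+-identityʳ i))
  go (suc e) i+e<p = ≤-trans
    (subst (λ z → f z ≤ f (i + e)) (sym (+-suc i e))
           (step (i + e) (≤-trans 1≤i (m≤m+n i e)) (subst (_≤ p) (+-suc i e) i+e<p)))
    (go e (≤-trans (m≤n+m (i + e) 1) (subst (_≤ p) (+-suc i e) i+e<p)))

firstBlock : ∀ q f → Sorted (suc q) f → 1 ≤ q →
  Σ ℕ λ t → 1 ≤ t × t ≤ q × (∀ i → 1 ≤ i → i ≤ t → f i ≡ f 1) × (t ≡ q ⊎ f (suc t) < f 1)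
firstBlock q f sorted 1≤q = extend (q ∸ 1) 1 (m∸n+n≡m 1≤q) ≤-refl 1≤q (λ i 1≤i i≤1 → cong f (≤-antisym i≤1 1≤i))
  where
  extend : ∀ n m → n + m ≡ q → 1 ≤ m → m ≤ q → (∀ i → 1 ≤ i → i ≤ m → f i ≡ f 1) →
           Σ ℕ λ t → 1 ≤ t × t ≤ q × (∀ i → 1 ≤ i → i ≤ t → f i ≡ f 1) × (t ≡ q ⊎ f (suc t) < f 1)
  extend zero    m e 1≤m m≤q block = m , 1≤m , m≤q , block , inj₁ e
  extend (suc n) m e 1≤m m≤q block with f (suc m) ≟ f 1
  ... | no  ne = m , 1≤m , m≤q , block , inj₂ (≤∧≢⇒< (sorted 1 (suc m) ≤-refl (s≤s z≤n) (s≤s m≤q)) ne)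
  ... | yes eq = extend n (suc m) (trans (+-suc n m) e) (≤-trans 1≤m (n≤1+n m))
                        (subst (suc m ≤_) e (s≤s (m≤n+m m n))) block′
    where
    block′ : ∀ i → 1 ≤ i → i ≤ suc m → f i ≡ f 1
    block′ i 1≤i i≤m+1 with m≤n⇒m<n∨m≡n i≤m+1
    ... | inj₁ i≤m = block i 1≤i (s≤s⁻¹ i≤m)
    ... | inj₂ refl = eq

m∸n≡suc[m∸suc[n]] : ∀ {m n} → n < m → m ∸ n ≡ suc (m ∸ suc n)
m∸n≡suc[m∸suc[n]] {suc m} {zero}  _        = refl
m∸n≡suc[m∸suc[n]] {suc m} {suc n} (s≤s n<m) = m∸n≡suc[m∸suc[n]] n<m

k*[k∸1]+k≡k*k : ∀ k → k * (k ∸ 1) + k ≡ k * k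
k*[k∸1]+k≡k*k zero    = refl
k*[k∸1]+k≡k*k (suc m) = lemma m
  where
  lemma : ∀ m → suc m * m + suc m ≡ suc m * suc m
  lemma = solve-∀

2∣k*[k∸1] : ∀ k → 2 ∣ k * (k ∸ 1)
2∣k*[k∸1] zero          = divides 0 refl
2∣k*[k∸1] (suc zero)    = divides 0 refl
2∣k*[k∸1] (suc (suc m)) with 2∣k*[k∸1] (suc m)
... | divides q e = divides (q + suc m) (trans (step m) (trans (cong (_+ 2 * suc m) e) (regroup q m)))
  where
  step : ∀ m → suc (suc m) * suc m ≡ suc m * m + 2 * suc m
  step = solve-∀
  regroup : ∀ q m → q * 2 + 2 * suc m ≡ (q + suc m) * 2
  regroup = solve-∀

even+even≢odd : ∀ x y L → 2 ∣ x → 2 ∣ y → ¬ x + y ≡ suc (L + L)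
even+even≢odd x y L (divides a ea) (divides b eb) eq = 2≢1 (∣1⇒≡1 (∣m+n∣m⇒∣n 2∣2L+1 (divides L (double L))))
  where
  2≢1 : ¬ 2 ≡ 1
  2≢1 ()
  double : ∀ L → L + L ≡ L * 2
  double = solve-∀
  2∣2L+1 : 2 ∣ (L + L) + 1
  2∣2L+1 = subst (2 ∣_) (trans (trans (sym (cong₂ _+_ ea eb)) eq) (+-comm 1 _))
                 (divides (a + b) (sym (*-distribʳ-+ 2 a b)))

above : ℕ → ℕ → ℕ
above k x with k <? x
... | yes _ = 1
... | no _  = 0

suc⊓≤⊓+above : ∀ k x → suc k ⊓ x ≤ k ⊓ x + above k x
suc⊓≤⊓+above k x with k <? x
... | yes k<x = subst₂ _≤_ (sym (m≤n⇒m⊓n≡m k<x)) (sym (cong (_+ 1) (m≤n⇒m⊓n≡m (<⇒≤ k<x))))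
                        (≤-reflexive (+-comm 1 k))
... | no  k≮x = subst₂ _≤_ (sym (m≥n⇒m⊓n≡n (m≤n⇒m≤1+n (≮⇒≥ k≮x))))
                        (sym (trans (+-identityʳ _) (m≥n⇒m⊓n≡n (≮⇒≥ k≮x)))) ≤-refl

*above≤⊓ : ∀ k x → k * above k x ≤ k ⊓ x
*above≤⊓ k x with k <? x
... | yes k<x = subst₂ _≤_ (sym (*-identityʳ k)) (sym (m≤n⇒m⊓n≡m (<⇒≤ k<x))) ≤-refl
... | no  _   = subst (_≤ k ⊓ x) (sym (*-zeroʳ k)) z≤n

*above+1≤⊓ : ∀ k x → 1 ≤ x → x ≤ k → k * above k x + 1 ≤ k ⊓ x
*above+1≤⊓ k x 1≤x x≤k with k <? x
... | yes k<x = ⊥-elim (<⇒≱ k<x x≤k)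
... | no  _   = subst₂ _≤_ (sym (cong (_+ 1) (*-zeroʳ k))) (sym (m≥n⇒m⊓n≡n x≤k)) 1≤x

suc[q]*q : ∀ q → suc q * q ≡ q * (q ∸ 1) + 2 * q
suc[q]*q zero    = refl
suc[q]*q (suc m) = lemma m
  where
  lemma : ∀ m → suc (suc m) * suc m ≡ suc m * m + 2 * suc m
  lemma = solve-∀

-- Choudum's induction step: lower the last entry of the leading block of maximal entries and the
-- last entry by one.
module Lowering (q : ℕ) (f : ℕ → ℕ) (sorted : Sorted (suc q) f) (even : 2 ∣ egLeft f (suc q))
                (eg : ErdősGallai (suc q) f) (1≤fp : 1 ≤ f (suc q))
                (t : ℕ) (1≤t : 1 ≤ t) (t≤q : t ≤ q)
                (block : ∀ i → 1 ≤ i → i ≤ t → f i ≡ f 1) (blockEnd : t ≡ q ⊎ f (suc t) < f 1) where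

  p = suc q
  a = f 1

  f' : ℕ → ℕ
  f' = lower (lower f t) p

  private
    1≤p : 1 ≤ p
    1≤p = s≤s z≤n

    t<p : t < p
    t<p = s≤s t≤q

    t≢p : ¬ t ≡ p
    t≢p t≡p = <-irrefl t≡p t<p

    fi≤a : ∀ i → 1 ≤ i → i ≤ p → f i ≤ a
    fi≤a i 1≤i i≤p = sorted 1 i ≤-refl 1≤i i≤p

    ft≡a : f t ≡ a
    ft≡a = block t 1≤t ≤-refl

    1≤a : 1 ≤ a
    1≤a = ≤-trans 1≤fp (sorted 1 p ≤-refl 1≤p ≤-refl)

    1≤ft : 1 ≤ f t
    1≤ft = subst (1 ≤_) (sym ft≡a) 1≤a

    ≤k+[p∸k] : ∀ k x → k ≤ p → x ≤ p → x ≤ k + (p ∸ k)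
    ≤k+[p∸k] k x k≤p x≤p = subst (x ≤_) (sym (m+[n∸m]≡n k≤p)) x≤p

  f'-≢ : ∀ x → ¬ x ≡ t → ¬ x ≡ p → f' x ≡ f x
  f'-≢ x x≢t x≢p = trans (lower-≢ (lower f t) x≢p) (lower-≢ f x≢t)

  f'-t : f' t ≡ a ∸ 1
  f'-t = trans (lower-≢ (lower f t) t≢p) (trans (cong (λ z → z ∸ δ t t) ft≡a) (cong (a ∸_) (δ-refl t)))

  f'-p : f' p ≡ f p ∸ 1
  f'-p = trans (cong (λ z → z ∸ δ p p) (lower-≢ f (≢-sym t≢p))) (cong (f p ∸_) (δ-refl p))

  f'≤f : ∀ i → f' i ≤ f i
  f'≤f i = ≤-trans (lower-≤ (lower f t) p i) (lower-≤ f t i)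

  egLeft-lowered : egLeft f p ≡ suc (suc (egLeft f' p))
  egLeft-lowered = trans (∑-lower f t 0 p 1≤t (<⇒≤ t<p) 1≤ft)
    (cong suc (∑-lower (lower f t) p 0 p 1≤p ≤-refl (subst (1 ≤_) (sym (lower-≢ f (≢-sym t≢p))) 1≤fp)))

  lowered-even : 2 ∣ egLeft f' p
  lowered-even = ∣m+n∣m⇒∣n (subst (2 ∣_) egLeft-lowered even) (divides 1 refl)

  lowered-sorted : Sorted p f'
  lowered-sorted i j 1≤i i≤j j≤p = from (i ≟ t) (i ≟ p)
    where
    belowBlockEnd : ∀ j → t ≤ j → j ≤ p → Dec (j ≡ t) → Dec (j ≡ p) → f' j ≤ f' t
    belowBlockEnd j t≤j j≤p (yes refl) _ = ≤-refl
    belowBlockEnd j t≤j j≤p (no _) (yes refl) = subst₂ _≤_ (sym f'-p) (sym f'-t) (∸-monoˡ-≤ 1 (fi≤a p 1≤p ≤-refl))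
    belowBlockEnd j t≤j j≤p (no j≢t) (no j≢p) =
      subst₂ _≤_ (sym (f'-≢ j j≢t j≢p)) (sym f'-t) (afterBlock blockEnd)
      where
      t<j : t < j
      t<j = ≤∧≢⇒< t≤j (≢-sym j≢t)
      afterBlock : t ≡ q ⊎ f (suc t) < a → f j ≤ a ∸ 1
      afterBlock (inj₁ refl) = ⊥-elim (<⇒≱ t<j (s≤s⁻¹ (≤∧≢⇒< j≤p j≢p)))
      afterBlock (inj₂ lt)   = ≤-trans (sorted (suc t) j (s≤s z≤n) t<j j≤p) (<⇒≤pred lt)
    from : Dec (i ≡ t) → Dec (i ≡ p) → f' j ≤ f' i
    from (no i≢t) (no i≢p) = subst (f' j ≤_) (sym (f'-≢ i i≢t i≢p)) (≤-trans (f'≤f j) (sorted i j 1≤i i≤j j≤p))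
    from _ (yes refl) = ≤-reflexive (cong f' (≤-antisym j≤p i≤j))
    from (yes refl) (no _) = belowBlockEnd j i≤j j≤p (j ≟ t) (j ≟ p)

  egTail : ℕ → (ℕ → ℕ) → ℕ
  egTail k g = ∑ (λ i → k ⊓ g i) k (p ∸ k)

  egTail-lowered : ∀ k → egTail k f ≤ egTail k f' + ∑ (δ t) k (p ∸ k) + ∑ (δ p) k (p ∸ k)
  egTail-lowered k = begin
    egTail k f
      ≤⟨ ∑-mono-≤ _ _ k (p ∸ k) (λ i _ _ → pointwise i) ⟩
    ∑ (λ i → k ⊓ f' i + δ t i + δ p i) k (p ∸ k)
      ≡⟨ ∑-distrib-+ (λ i → k ⊓ f' i + δ t i) (δ p) k (p ∸ k) ⟩
    ∑ (λ i → k ⊓ f' i + δ t i) k (p ∸ k) + ∑ (δ p) k (p ∸ k)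
      ≡⟨ cong (_+ ∑ (δ p) k (p ∸ k)) (∑-distrib-+ (λ i → k ⊓ f' i) (δ t) k (p ∸ k)) ⟩
    egTail k f' + ∑ (δ t) k (p ∸ k) + ∑ (δ p) k (p ∸ k) ∎
    where
    open ≤-Reasoning
    pointwise : ∀ i → k ⊓ f i ≤ k ⊓ f' i + δ t i + δ p i
    pointwise i = begin
      k ⊓ f i                          ≤⟨ ⊓-∸-+ k (f i) (δ t i) ⟩
      k ⊓ lower f t i + δ t i          ≤⟨ +-monoˡ-≤ (δ t i) (⊓-∸-+ k (lower f t i) (δ p i)) ⟩
      k ⊓ f' i + δ p i + δ t i         ≡⟨ +-assoc (k ⊓ f' i) _ _ ⟩
      k ⊓ f' i + (δ p i + δ t i)       ≡⟨ cong (k ⊓ f' i +_) (+-comm (δ p i) _) ⟩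
      k ⊓ f' i + (δ t i + δ p i)       ≡⟨ sym (+-assoc (k ⊓ f' i) _ _) ⟩
      k ⊓ f' i + δ t i + δ p i         ∎

  ∑δp : ∀ k → k < p → ∑ (δ p) k (p ∸ k) ≡ 1
  ∑δp k k<p = ∑-δ k (p ∸ k) p k<p (≤k+[p∸k] k p (<⇒≤ k<p) ≤-refl)

  egRight-top : ∀ g → egRight p g p ≡ p * (p ∸ 1)
  egRight-top g = trans (cong (λ z → p * (p ∸ 1) + ∑ (λ i → p ⊓ g i) p z) (n∸n≡0 p)) (+-identityʳ _)

  egLeft-lowered-inBlock : ∀ k → k < t → egLeft f' k ≡ egLeft f k
  egLeft-lowered-inBlock k k<t =
    trans (∑-lower-outside (lower f t) p 0 k (λ i _ i≤k i≡p → <-irrefl i≡p (≤-<-trans i≤k (<-trans k<t t<p))))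
          (∑-lower-outside f t 0 k (λ i _ i≤k i≡t → <-irrefl i≡t (≤-<-trans i≤k k<t)))

  egLeft-block : ∀ k → k ≤ t → egLeft f k ≡ k * a
  egLeft-block k k≤t = trans (∑-cong f (λ _ → a) 0 k (λ i 1≤i i≤k → block i 1≤i (≤-trans i≤k k≤t))) (∑-const a 0 k)

  -- Inside the block, below a and at least f p, the inequality is strict: otherwise the inequality at
  -- k + 1 forces a ≤ k + N, with N the number of later entries exceeding k, while the equality at k
  -- gives k a ≥ k² + k N + f p > k (k + N).
  egLeft<egRight-inBlock : ∀ k → 1 ≤ k → k < t → k < a → f p ≤ k → egLeft f k < egRight p f k
  egLeft<egRight-inBlock k 1≤k k<t k<a fp≤k =
    ≤∧≢⇒< (eg k 1≤k (≤-trans (<⇒≤ k<t) (<⇒≤ t<p))) notTight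
    where
    k+1<p : suc k < p
    k+1<p = ≤-<-trans k<t t<p
    m = p ∸ suc k
    T : ℕ → ℕ
    T j = ∑ (λ i → j ⊓ f i) (suc k) m
    N = ∑ (λ i → above k (f i)) (suc k) m
    egRight-k : egRight p f k ≡ k * (k ∸ 1) + (k + T k)
    egRight-k = cong (k * (k ∸ 1) +_) (trans (cong (∑ (λ i → k ⊓ f i) k) (m∸n≡suc[m∸suc[n]] (<⇒≤ k+1<p)))
      (cong (_+ T k) (trans (cong (k ⊓_) (block (suc k) (s≤s z≤n) k<t)) (m≤n⇒m⊓n≡m (<⇒≤ k<a)))))
    T-suc : T (suc k) ≤ T k + N
    T-suc = subst (T (suc k) ≤_) (∑-distrib-+ (λ i → k ⊓ f i) (λ i → above k (f i)) (suc k) m)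
                  (∑-mono-≤ _ _ (suc k) m (λ i _ _ → suc⊓≤⊓+above k (f i)))
    kN<T : k * N + 1 ≤ T k
    kN<T = begin
      k * N + 1
        ≡⟨ cong₂ _+_ (sym (∑-distribˡ-* k (λ i → above k (f i)) (suc k) m))
                     (sym (∑-δ (suc k) m p k+1<p (≤k+[p∸k] (suc k) p (<⇒≤ k+1<p) ≤-refl))) ⟩
      ∑ (λ i → k * above k (f i)) (suc k) m + ∑ (δ p) (suc k) m
        ≡⟨ sym (∑-distrib-+ _ (δ p) (suc k) m) ⟩
      ∑ (λ i → k * above k (f i) + δ p i) (suc k) m
        ≤⟨ ∑-mono-≤ _ _ (suc k) m (λ i _ _ → pointwise i (i ≟ p)) ⟩
      T k ∎
      where
      open ≤-Reasoning
      pointwise : ∀ i → Dec (i ≡ p) → k * above k (f i) + δ p i ≤ k ⊓ f i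
      pointwise i (yes refl) = subst (λ z → k * above k (f i) + z ≤ k ⊓ f i) (sym (δ-refl i))
                                     (*above+1≤⊓ k (f i) 1≤fp fp≤k)
      pointwise i (no i≢p)   = subst (λ z → k * above k (f i) + z ≤ k ⊓ f i) (sym (δ-≢ i≢p))
                                     (subst (_≤ k ⊓ f i) (sym (+-identityʳ _)) (*above≤⊓ k (f i)))
    eg-k+1 : suc k * a ≤ suc k * k + T (suc k)
    eg-k+1 = subst (_≤ suc k * k + T (suc k)) (egLeft-block (suc k) k<t) (eg (suc k) (s≤s z≤n) (<⇒≤ k+1<p))
    notTight : ¬ egLeft f k ≡ egRight p f k
    notTight tight = <-irrefl refl (begin-strict
      k * a            ≤⟨ *-monoʳ-≤ k a≤k+N ⟩
      k * (k + N)      ≡⟨ *-distribˡ-+ k k N ⟩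
      k * k + k * N    <⟨ +-monoʳ-< (k * k) (subst (_≤ T k) (+-comm _ 1) kN<T) ⟩
      k * k + T k      ≡⟨ sym ka≡ ⟩
      k * a            ∎)
      where
      open ≤-Reasoning
      ka≡ : k * a ≡ k * k + T k
      ka≡ = trans (sym (egLeft-block k (<⇒≤ k<t))) (trans tight (trans egRight-k
              (trans (sym (+-assoc (k * (k ∸ 1)) k (T k))) (cong (_+ T k) (k*[k∸1]+k≡k*k k)))))
      regroup : ∀ k t n → suc k * k + (t + n) ≡ (k * k + t) + (k + n)
      regroup = solve-∀
      a≤k+N : a ≤ k + N
      a≤k+N = +-cancelˡ-≤ (k * k + T k) a (k + N) (begin
        k * k + T k + a       ≡⟨ cong (_+ a) (sym ka≡) ⟩
        k * a + a             ≡⟨ +-comm (k * a) a ⟩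
        suc k * a             ≤⟨ eg-k+1 ⟩
        suc k * k + T (suc k) ≤⟨ +-monoʳ-≤ (suc k * k) T-suc ⟩
        suc k * k + (T k + N) ≡⟨ regroup k (T k) N ⟩
        k * k + T k + (k + N) ∎)

  lowered-EG-whole : egLeft f' p ≤ egRight p f' p
  lowered-EG-whole = begin
    egLeft f' p       ≤⟨ ∑-mono-≤ f' f 0 p (λ i _ _ → f'≤f i) ⟩
    egLeft f p        ≤⟨ eg p 1≤p ≤-refl ⟩
    egRight p f p     ≡⟨ egRight-top f ⟩
    p * (p ∸ 1)       ≡⟨ sym (egRight-top f') ⟩
    egRight p f' p    ∎
    where open ≤-Reasoning

  lowered-EG-afterBlock : ∀ k → 1 ≤ k → t ≤ k → k < p → egLeft f' k ≤ egRight p f' k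
  lowered-EG-afterBlock k 1≤k t≤k k<p = s≤s⁻¹ (begin
    suc (egLeft f' k)                             ≡⟨ sym egLeft-k ⟩
    egLeft f k                                    ≤⟨ eg k 1≤k (<⇒≤ k<p) ⟩
    k * (k ∸ 1) + egTail k f                      ≤⟨ +-monoʳ-≤ (k * (k ∸ 1)) tail≤ ⟩
    k * (k ∸ 1) + suc (egTail k f')               ≡⟨ +-suc _ _ ⟩
    suc (egRight p f' k)                          ∎)
    where
    open ≤-Reasoning
    egLeft-k : egLeft f k ≡ suc (egLeft f' k)
    egLeft-k = trans (∑-lower f t 0 k 1≤t t≤k 1≤ft)
      (cong suc (sym (∑-lower-outside (lower f t) p 0 k (λ i _ i≤k i≡p → <-irrefl i≡p (≤-<-trans i≤k k<p)))))
    tail≤ : egTail k f ≤ suc (egTail k f')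
    tail≤ = subst (egTail k f ≤_)
      (trans (cong₂ (λ u v → egTail k f' + u + v)
                    (∑-δ-outside t k (p ∸ k) (λ i k<i _ i≡t → <-irrefl (sym i≡t) (≤-<-trans t≤k k<i))) (∑δp k k<p))
             (trans (cong (_+ 1) (+-identityʳ _)) (+-comm _ 1)))
      (egTail-lowered k)

  lowered-EG-a<k : ∀ k → k ≤ p → a < k → egLeft f' k ≤ egRight p f' k
  lowered-EG-a<k k k≤p a<k = begin
    egLeft f' k          ≤⟨ ∑-mono-≤ f' (λ _ → k ∸ 1) 0 k (λ i 1≤i i≤k →
                              ≤-trans (f'≤f i) (≤-trans (fi≤a i 1≤i (≤-trans i≤k k≤p)) (<⇒≤pred a<k))) ⟩
    ∑ (λ _ → k ∸ 1) 0 k  ≡⟨ ∑-const (k ∸ 1) 0 k ⟩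
    k * (k ∸ 1)          ≤⟨ m≤m+n _ _ ⟩
    egRight p f' k       ∎
    where open ≤-Reasoning

  -- When k = a, equality for f would make k (k − 1) + egLeft f p odd; so egRight p f k ≥ egLeft f k + 2,
  -- which absorbs the loss of at most 2 on the right.
  lowered-EG-a≡k : ∀ k → 1 ≤ k → k < t → a ≡ k → egLeft f' k ≤ egRight p f' k
  lowered-EG-a≡k k 1≤k k<t refl =
    ≤-trans (≤-reflexive (egLeft-lowered-inBlock k k<t)) (+-cancelʳ-≤ 2 _ _ (≤-trans L+2≤R R≤R'+2))
    where
    k<p = <-trans k<t t<p
    L = egLeft f k
    tl = ∑ f k (p ∸ k)
    R = egRight p f k
    tail≡ : egTail k f ≡ tl
    tail≡ = ∑-cong _ _ k (p ∸ k) (λ i k<i i≤ → m≥n⇒m⊓n≡n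
              (fi≤a i (≤-trans 1≤k (<⇒≤ k<i)) (subst (i ≤_) (m+[n∸m]≡n (<⇒≤ k<p)) i≤)))
    k+1<p : suc k < p
    k+1<p = ≤-<-trans k<t t<p
    k+1≤tl : suc k ≤ tl
    k+1≤tl = subst (suc k ≤_) (sym (cong (∑ f k) (m∸n≡suc[m∸suc[n]] (<⇒≤ k+1<p))))
      (subst (_≤ f (suc k) + ∑ f (suc k) (p ∸ suc k)) (+-comm k 1)
        (+-mono-≤ (≤-reflexive (sym (block (suc k) (s≤s z≤n) k<t)))
                  (≤-trans 1≤fp (term≤∑ f (suc k) (p ∸ suc k) p k+1<p (≤k+[p∸k] (suc k) p (<⇒≤ k+1<p) ≤-refl)))))
    L<R : suc L ≤ R
    L<R = begin
      suc L                     ≡⟨ cong suc (trans (egLeft-block k (<⇒≤ k<t)) (sym (k*[k∸1]+k≡k*k k))) ⟩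
      suc (k * (k ∸ 1) + k)     ≡⟨ sym (+-suc _ k) ⟩
      k * (k ∸ 1) + suc k       ≤⟨ +-monoʳ-≤ _ k+1≤tl ⟩
      k * (k ∸ 1) + tl          ≡⟨ cong (k * (k ∸ 1) +_) (sym tail≡) ⟩
      R                         ∎
      where open ≤-Reasoning
    R≢L+1 : ¬ R ≡ suc L
    R≢L+1 e = even+even≢odd (k * (k ∸ 1)) (egLeft f p) L (2∣k*[k∸1] k) even (begin
      k * (k ∸ 1) + egLeft f p     ≡⟨ cong (k * (k ∸ 1) +_) (∑-split f (<⇒≤ k<p)) ⟩
      k * (k ∸ 1) + (L + tl)       ≡⟨ regroup (k * (k ∸ 1)) L tl ⟩
      (k * (k ∸ 1) + tl) + L       ≡⟨ cong (λ z → (k * (k ∸ 1) + z) + L) (sym tail≡) ⟩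
      R + L                        ≡⟨ cong (_+ L) e ⟩
      suc (L + L)                  ∎)
      where
      open ≡-Reasoning
      regroup : ∀ x y z → x + (y + z) ≡ (x + z) + y
      regroup = solve-∀
    L+2≤R : L + 2 ≤ R
    L+2≤R = subst (_≤ R) (+-comm 2 L) (≤∧≢⇒< L<R (≢-sym R≢L+1))
    R≤R'+2 : R ≤ egRight p f' k + 2
    R≤R'+2 = begin
      R                                                        ≤⟨ +-monoʳ-≤ _ (egTail-lowered k) ⟩
      k * (k ∸ 1) + (egTail k f' + ∑ (δ t) k (p ∸ k) + ∑ (δ p) k (p ∸ k))
        ≡⟨ cong₂ (λ u v → k * (k ∸ 1) + (egTail k f' + u + v))
                 (∑-δ k (p ∸ k) t k<t (≤k+[p∸k] k t (<⇒≤ k<p) (<⇒≤ t<p))) (∑δp k k<p) ⟩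
      k * (k ∸ 1) + (egTail k f' + 1 + 1)                      ≡⟨ regroup (k * (k ∸ 1)) (egTail k f') ⟩
      egRight p f' k + 2                                       ∎
      where
      open ≤-Reasoning
      regroup : ∀ x y → x + (y + 1 + 1) ≡ x + y + 2
      regroup = solve-∀

  k⊓f'-t : ∀ k → k < a → k ⊓ f' t ≡ k
  k⊓f'-t k k<a = trans (cong (k ⊓_) f'-t) (m≤n⇒m⊓n≡m (<⇒≤pred k<a))

  lowered-EG-k<a : ∀ k → 1 ≤ k → k < t → k < a → egLeft f' k ≤ egRight p f' k
  lowered-EG-k<a k 1≤k k<t k<a with f p ≤? k
  ... | yes fp≤k = s≤s⁻¹ (begin
    suc (egLeft f' k)                ≡⟨ cong suc (egLeft-lowered-inBlock k k<t) ⟩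
    suc (egLeft f k)                 ≤⟨ egLeft<egRight-inBlock k 1≤k k<t k<a fp≤k ⟩
    k * (k ∸ 1) + egTail k f         ≤⟨ +-monoʳ-≤ _ tail≤ ⟩
    k * (k ∸ 1) + (egTail k f' + 1)  ≡⟨ trans (cong (k * (k ∸ 1) +_) (+-comm _ 1)) (+-suc _ _) ⟩
    suc (egRight p f' k)             ∎)
    where
    open ≤-Reasoning
    pointwise : ∀ i → Dec (i ≡ t) → k ⊓ f i ≤ k ⊓ f' i + δ p i
    pointwise i (yes refl) = ≤-trans (m⊓n≤m k (f i)) (≤-trans (≤-reflexive (sym (k⊓f'-t k k<a))) (m≤m+n _ _))
    pointwise i (no i≢t)   = subst (λ z → k ⊓ f i ≤ k ⊓ ((f i ∸ z) ∸ δ p i) + δ p i) (sym (δ-≢ i≢t))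
                                   (⊓-∸-+ k (f i) (δ p i))
    tail≤ : egTail k f ≤ egTail k f' + 1
    tail≤ = begin
      egTail k f                                  ≤⟨ ∑-mono-≤ _ _ k (p ∸ k) (λ i _ _ → pointwise i (i ≟ t)) ⟩
      ∑ (λ i → k ⊓ f' i + δ p i) k (p ∸ k)        ≡⟨ ∑-distrib-+ (λ i → k ⊓ f' i) (δ p) k (p ∸ k) ⟩
      egTail k f' + ∑ (δ p) k (p ∸ k)             ≡⟨ cong (egTail k f' +_) (∑δp k (<-trans k<t t<p)) ⟩
      egTail k f' + 1                             ∎
  ... | no fp≰k = begin
    egLeft f' k                ≡⟨ egLeft-lowered-inBlock k k<t ⟩
    egLeft f k                 ≤⟨ eg k 1≤k (<⇒≤ (<-trans k<t t<p)) ⟩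
    k * (k ∸ 1) + egTail k f   ≤⟨ +-monoʳ-≤ _ (∑-mono-≤ _ _ k (p ∸ k) (λ i _ _ → pointwise i (i ≟ t) (i ≟ p))) ⟩
    egRight p f' k             ∎
    where
    open ≤-Reasoning
    pointwise : ∀ i → Dec (i ≡ t) → Dec (i ≡ p) → k ⊓ f i ≤ k ⊓ f' i
    pointwise i (yes refl) _ = ≤-trans (m⊓n≤m k (f i)) (≤-reflexive (sym (k⊓f'-t k k<a)))
    pointwise i (no _) (yes refl) = ≤-trans (m⊓n≤m k (f i))
      (≤-reflexive (sym (trans (cong (k ⊓_) f'-p) (m≤n⇒m⊓n≡m (<⇒≤pred (≰⇒> fp≰k))))))
    pointwise i (no i≢t) (no i≢p) = ≤-reflexive (cong (k ⊓_) (sym (f'-≢ i i≢t i≢p)))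

  lowered-ErdősGallai : ErdősGallai p f'
  lowered-ErdősGallai k 1≤k k≤p with k ≟ p | t ≤? k
  ... | yes refl | _       = lowered-EG-whole
  ... | no k≢p   | yes t≤k = lowered-EG-afterBlock k 1≤k t≤k (≤∧≢⇒< k≤p k≢p)
  ... | no _     | no t≰k with <-cmp a k
  ...   | tri< a<k _ _ = lowered-EG-a<k k k≤p a<k
  ...   | tri≈ _ a≡k _ = lowered-EG-a≡k k 1≤k (≰⇒> t≰k) a≡k
  ...   | tri> _ _ k<a = lowered-EG-k<a k 1≤k (≰⇒> t≰k) k<a

restrict : ℕ → (ℕ → ℕ → Bool) → ℕ → ℕ → Bool
restrict q A i j = A i j ∧ (does (i ≤? q) ∧ does (j ≤? q))

restrict-isSimple : ∀ q A → IsSimple A → IsSimple (restrict q A)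
restrict-isSimple q A (sym-A , loopless) =
  (λ i j → cong₂ _∧_ (sym-A i j) (Boolₚ.∧-comm (does (i ≤? q)) _)) , (λ i → cong (_∧ _) (loopless i))

graphicOn-extendZero : ∀ q f → f (suc q) ≡ 0 → GraphicOn q f → GraphicOn (suc q) f
graphicOn-extendZero q f fq+1≡0 (A , G , R) = restrict q A , restrict-isSimple q A G , R′
  where
  R′ : Realises (suc q) (restrict q A) f
  R′ x 1≤x x≤q+1 with x ≤? q
  ... | yes x≤q = begin
    deg (suc q) (restrict q A) x
      ≡⟨ ∑-suc _ 0 q ⟩
    ∑ (λ j → bit (restrict q A x j)) 0 q + bit (restrict q A x (suc q))
      ≡⟨ cong₂ _+_ (∑-cong _ _ 0 q (λ j _ j≤q → cong bit (inside j j≤q))) (cong bit outside) ⟩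
    deg q A x + 0  ≡⟨ +-identityʳ _ ⟩
    deg q A x      ≡⟨ R x 1≤x x≤q ⟩
    f x            ∎
    where
    open ≡-Reasoning
    inside : ∀ j → j ≤ q → restrict q A x j ≡ A x j
    inside j j≤q = trans (cong₂ (λ u v → A x j ∧ (u ∧ v)) (dec-true (x ≤? q) x≤q) (dec-true (j ≤? q) j≤q))
                         (Boolₚ.∧-identityʳ _)
    outside : restrict q A x (suc q) ≡ false
    outside = trans (cong (λ z → A x (suc q) ∧ (does (x ≤? q) ∧ z)) (dec-false (suc q ≤? q) (<-irrefl refl)))
                    (trans (cong (A x (suc q) ∧_) (Boolₚ.∧-zeroʳ _)) (Boolₚ.∧-zeroʳ _))
  ... | no x≰q = begin
    deg (suc q) (restrict q A) x  ≡⟨ ∑-cong _ (λ _ → 0) 0 (suc q) (λ j _ _ → cong bit (outside j)) ⟩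
    ∑ (λ _ → 0) 0 (suc q)         ≡⟨ ∑-zero 0 (suc q) ⟩
    0                             ≡⟨ sym fq+1≡0 ⟩
    f (suc q)                     ≡⟨ cong f (sym (≤-antisym x≤q+1 (≰⇒> x≰q))) ⟩
    f x                           ∎
    where
    open ≡-Reasoning
    outside : ∀ j → restrict q A x j ≡ false
    outside j = trans (cong (λ z → A x j ∧ (z ∧ does (j ≤? q))) (dec-false (x ≤? q) x≰q)) (Boolₚ.∧-zeroʳ _)

ErdősGallai-dropZero : ∀ q f → f (suc q) ≡ 0 → ErdősGallai (suc q) f → ErdősGallai q f
ErdősGallai-dropZero q f fq+1≡0 eg k 1≤k k≤q =
  subst (egLeft f k ≤_) (cong (k * (k ∸ 1) +_) tail≡) (eg k 1≤k (m≤n⇒m≤1+n k≤q))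
  where
  open ≡-Reasoning
  S = ∑ (λ i → k ⊓ f i) k (q ∸ k)
  tail≡ : ∑ (λ i → k ⊓ f i) k (suc q ∸ k) ≡ S
  tail≡ = begin
    ∑ (λ i → k ⊓ f i) k (suc q ∸ k)    ≡⟨ cong (∑ (λ i → k ⊓ f i) k) (+-∸-assoc 1 k≤q) ⟩
    ∑ (λ i → k ⊓ f i) k (suc (q ∸ k))  ≡⟨ ∑-suc _ k (q ∸ k) ⟩
    S + k ⊓ f (suc (k + (q ∸ k)))      ≡⟨ cong (λ z → S + k ⊓ f (suc z)) (m+[n∸m]≡n k≤q) ⟩
    S + k ⊓ f (suc q)                  ≡⟨ cong (λ z → S + k ⊓ z) fq+1≡0 ⟩
    S + k ⊓ 0                          ≡⟨ cong (S +_) (⊓-zeroʳ k) ⟩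
    S + 0                              ≡⟨ +-identityʳ _ ⟩
    S                                  ∎

f1≤p∸1 : ∀ p f → egLeft f 1 ≤ egRight p f 1 → f 1 ≤ p ∸ 1
f1≤p∸1 p f eg-1 = begin
  f 1                        ≡⟨ sym (+-identityʳ _) ⟩
  egLeft f 1                 ≤⟨ eg-1 ⟩
  ∑ (λ i → 1 ⊓ f i) 1 (p ∸ 1) ≤⟨ ∑-mono-≤ _ (λ _ → 1) 1 (p ∸ 1) (λ i _ _ → m⊓n≤m 1 (f i)) ⟩
  ∑ (λ _ → 1) 1 (p ∸ 1)      ≡⟨ ∑-one 1 (p ∸ 1) ⟩
  p ∸ 1                      ∎
  where open ≤-Reasoning

-- μ bounds p + egLeft f p, which each lowering step decreases.
erdősGallai-bounded : ∀ μ p f → p + egLeft f p ≤ μ → Sorted p f → 2 ∣ egLeft f p → ErdősGallai p f → GraphicOn p f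
erdősGallai-bounded μ       zero    f _ _ _ _ =
  (λ _ _ → false) , ((λ _ _ → refl) , (λ _ → refl)) , (λ i 1≤i i≤0 → ⊥-elim (<⇒≱ 1≤i i≤0))
erdősGallai-bounded zero    (suc q) f () _ _ _
erdősGallai-bounded (suc μ) (suc q) f size sorted even eg with f (suc q) ≟ 0
... | yes fq+1≡0 = graphicOn-extendZero q f fq+1≡0
  (erdősGallai-bounded μ q f (s≤s⁻¹ (subst (λ z → suc q + z ≤ suc μ) egLeft≡ size))
        (λ i j 1≤i i≤j j≤q → sorted i j 1≤i i≤j (m≤n⇒m≤1+n j≤q))
        (subst (2 ∣_) egLeft≡ even) (ErdősGallai-dropZero q f fq+1≡0 eg))
  where
  egLeft≡ : egLeft f (suc q) ≡ egLeft f q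
  egLeft≡ = trans (∑-suc f 0 q) (trans (cong (egLeft f q +_) fq+1≡0) (+-identityʳ _))
... | no fq+1≢0 with q
...   | zero = ⊥-elim (fq+1≢0 (n≤0⇒n≡0 (f1≤p∸1 1 f (eg 1 ≤-refl ≤-refl))))
...   | suc q′ with firstBlock (suc q′) f sorted (s≤s z≤n)
...     | t , 1≤t , t≤q , block , blockEnd =
  Raise.graphicOn-raise p f t 1≤t (s≤s t≤q) 1≤ft 1≤fp (λ i 1≤i i≤p → sorted i p 1≤i i≤p ≤-refl) ft<p
    (erdősGallai-bounded μ p f' size′ lowered-sorted lowered-even lowered-ErdősGallai)
  where
  p = suc (suc q′)
  1≤fp : 1 ≤ f p
  1≤fp = n≢0⇒n>0 fq+1≢0
  open Lowering (suc q′) f sorted even eg 1≤fp t 1≤t t≤q block blockEnd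
    using (f'; egLeft-lowered; lowered-sorted; lowered-even; lowered-ErdősGallai)
  1≤ft : 1 ≤ f t
  1≤ft = ≤-trans 1≤fp (sorted t p 1≤t (m≤n⇒m≤1+n t≤q) ≤-refl)
  ft<p : f t < p
  ft<p = s≤s (subst (_≤ suc q′) (sym (block t 1≤t ≤-refl)) (f1≤p∸1 p f (eg 1 ≤-refl (s≤s z≤n))))
  size′ : p + egLeft f' p ≤ μ
  size′ = s≤s⁻¹ (≤-trans (≤-trans (n≤1+n _) (≤-reflexive (sym p+egLeft≡))) size)
    where
    p+egLeft≡ : p + egLeft f p ≡ suc (suc (p + egLeft f' p))
    p+egLeft≡ = trans (cong (p +_) egLeft-lowered) (trans (+-suc p _) (cong suc (+-suc p _)))

erdősGallai : ∀ p f → Sorted p f → 2 ∣ egLeft f p → ErdősGallai p f → GraphicOn p f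
erdősGallai p f = erdősGallai-bounded (p + egLeft f p) p f ≤-refl

egRight-constTail-step : ∀ q u x → x ≤ q + u →
  q * (q ∸ 1) + suc u * (q ⊓ x) + x ≤ suc q * q + u * (suc q ⊓ x)
egRight-constTail-step q u x x≤q+u with x ≤? q
... | yes x≤q = begin
  Z + suc u * (q ⊓ x) + x    ≡⟨ cong (λ z → Z + suc u * z + x) (m≥n⇒m⊓n≡n x≤q) ⟩
  Z + suc u * x + x          ≡⟨ regroup Z u x ⟩
  Z + 2 * x + u * x          ≤⟨ +-monoˡ-≤ (u * x) (+-monoʳ-≤ Z (*-monoʳ-≤ 2 x≤q)) ⟩
  Z + 2 * q + u * x          ≡⟨ cong₂ (λ a b → a + u * b) (sym (suc[q]*q q)) (sym (m≥n⇒m⊓n≡n (m≤n⇒m≤1+n x≤q))) ⟩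
  suc q * q + u * (suc q ⊓ x) ∎
  where
  open ≤-Reasoning
  Z = q * (q ∸ 1)
  regroup : ∀ Z u x → Z + suc u * x + x ≡ Z + 2 * x + u * x
  regroup = solve-∀
... | no x≰q = begin
  Z + suc u * (q ⊓ x) + x    ≡⟨ cong (λ z → Z + suc u * z + x) (m≤n⇒m⊓n≡m (<⇒≤ q<x)) ⟩
  Z + suc u * q + x          ≤⟨ +-monoʳ-≤ (Z + suc u * q) x≤q+u ⟩
  Z + suc u * q + (q + u)    ≡⟨ regroup Z u q ⟩
  Z + 2 * q + u * suc q      ≡⟨ cong₂ (λ a b → a + u * b) (sym (suc[q]*q q)) (sym (m≤n⇒m⊓n≡m q<x)) ⟩
  suc q * q + u * (suc q ⊓ x) ∎
  where
  open ≤-Reasoning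
  Z = q * (q ∸ 1)
  q<x = ≰⇒> x≰q
  regroup : ∀ Z u q → Z + suc u * q + (q + u) ≡ Z + 2 * q + u * suc q
  regroup = solve-∀

ErdősGallai-constTail : ∀ p f K x → 1 ≤ K → K ≤ p → Sorted p f → (∀ i → K < i → i ≤ p → f i ≡ x) →
                        (∀ k → 1 ≤ k → k ≤ K → egLeft f k ≤ egRight p f k) → ErdősGallai p f
ErdősGallai-constTail p f K x 1≤K K≤p sorted tail upToK k 1≤k k≤p with k ≤? K
... | yes k≤K = upToK k 1≤k k≤K
... | no  k≰K = subst (λ z → egLeft f z ≤ egRight p f z) (m+[n∸m]≡n K≤k)
                      (beyond (k ∸ K) (subst (_≤ p) (sym (m+[n∸m]≡n K≤k)) k≤p))
  where
  K≤k = <⇒≤ (≰⇒> k≰K)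
  K<p : K < p
  K<p = <-≤-trans (≰⇒> k≰K) k≤p
  x≤p∸1 : x ≤ p ∸ 1
  x≤p∸1 = begin
    x      ≡⟨ sym (tail p K<p ≤-refl) ⟩
    f p    ≤⟨ sorted 1 p ≤-refl (≤-trans 1≤K K≤p) ≤-refl ⟩
    f 1    ≤⟨ f1≤p∸1 p f (upToK 1 ≤-refl 1≤K) ⟩
    p ∸ 1  ∎
    where open ≤-Reasoning
  egRight-tail : ∀ q → K ≤ q → q ≤ p → egRight p f q ≡ q * (q ∸ 1) + (p ∸ q) * (q ⊓ x)
  egRight-tail q K≤q q≤p = cong (q * (q ∸ 1) +_) (trans
    (∑-cong _ (λ _ → q ⊓ x) q (p ∸ q)
            (λ i q<i i≤ → cong (q ⊓_) (tail i (≤-<-trans K≤q q<i) (subst (i ≤_) (m+[n∸m]≡n q≤p) i≤))))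
    (∑-const (q ⊓ x) q (p ∸ q)))
  beyond : ∀ j → K + j ≤ p → egLeft f (K + j) ≤ egRight p f (K + j)
  beyond zero    _   = subst (λ z → egLeft f z ≤ egRight p f z) (sym (+-identityʳ K)) (upToK K 1≤K ≤-refl)
  beyond (suc j) K+j<p = subst (λ z → egLeft f z ≤ egRight p f z) (sym (+-suc K j)) (begin
    egLeft f (suc q)                                    ≡⟨ ∑-suc f 0 q ⟩
    egLeft f q + f (suc q)                              ≡⟨ cong (egLeft f q +_) (tail (suc q) (s≤s (m≤m+n K j)) q<p) ⟩
    egLeft f q + x                                      ≤⟨ +-monoˡ-≤ x (beyond j (<⇒≤ q<p)) ⟩
    egRight p f q + x                                   ≡⟨ cong (_+ x) (egRight-tail q (m≤m+n K j) (<⇒≤ q<p)) ⟩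
    q * (q ∸ 1) + (p ∸ q) * (q ⊓ x) + x                 ≡⟨ cong (λ z → q * (q ∸ 1) + z * (q ⊓ x) + x) (m∸n≡suc[m∸suc[n]] q<p) ⟩
    q * (q ∸ 1) + suc (p ∸ suc q) * (q ⊓ x) + x         ≤⟨ egRight-constTail-step q (p ∸ suc q) x x≤q+u ⟩
    suc q * q + (p ∸ suc q) * (suc q ⊓ x)               ≡⟨ sym (egRight-tail (suc q) (≤-trans (m≤m+n K j) (n≤1+n _)) q<p) ⟩
    egRight p f (suc q)                                 ∎)
    where
    open ≤-Reasoning
    q = K + j
    q<p : suc q ≤ p
    q<p = subst (_≤ p) (+-suc K j) K+j<p
    x≤q+u : x ≤ q + (p ∸ suc q)
    x≤q+u = subst (x ≤_) (cong pred (sym (m+[n∸m]≡n q<p))) x≤p∸1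

-- Sequences as lists

-- nth l i is the term of index i counted from 0, and entry l i the term of index i counted from 1;
-- both are 0 outside the list.
nth : List ℕ → ℕ → ℕ
nth []      _       = 0
nth (x ∷ l) zero    = x
nth (x ∷ l) (suc i) = nth l i

entry : List ℕ → ℕ → ℕ
entry l i = nth l (i ∸ 1)

nth-++ˡ : ∀ (l m : List ℕ) j → j < length l → nth (l ++ m) j ≡ nth l j
nth-++ˡ (x ∷ l) m zero    _         = refl
nth-++ˡ (x ∷ l) m (suc j) (s≤s j<l) = nth-++ˡ l m j j<l

nth-++ʳ : ∀ (l m : List ℕ) j → nth (l ++ m) (length l + j) ≡ nth m j
nth-++ʳ []      m j = refl
nth-++ʳ (x ∷ l) m j = nth-++ʳ l m j

nth-replicate : ∀ C x j → j < C → nth (replicate C x) j ≡ x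
nth-replicate (suc C) x zero    _         = refl
nth-replicate (suc C) x (suc j) (s≤s j<C) = nth-replicate C x j j<C

nth-map : ∀ (g : ℕ → ℕ) (l : List ℕ) j → j < length l → nth (map g l) j ≡ g (nth l j)
nth-map g (x ∷ l) zero    _         = refl
nth-map g (x ∷ l) (suc j) (s≤s j<l) = nth-map g l j j<l

nth-applyUpTo : ∀ (h : ℕ → ℕ) n j → j < n → nth (applyUpTo h n) j ≡ h j
nth-applyUpTo h (suc n) zero    _         = refl
nth-applyUpTo h (suc n) (suc j) (s≤s j<n) = nth-applyUpTo (λ i → h (suc i)) n j j<n

nth-drop : ∀ r (l : List ℕ) j → nth (drop r l) j ≡ nth l (r + j)
nth-drop zero    l       j = refl
nth-drop (suc r) []      j = refl
nth-drop (suc r) (x ∷ l) j = nth-drop r l j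

take-applyUpTo : ∀ (h : ℕ → ℕ) r n → r ≤ n → take r (applyUpTo h n) ≡ applyUpTo h r
take-applyUpTo h zero    n       _         = refl
take-applyUpTo h (suc r) (suc n) (s≤s r≤n) = cong (h 0 ∷_) (take-applyUpTo (λ i → h (suc i)) r n r≤n)

take-++ : ∀ k (l m : List ℕ) → k ≤ length l → take k (l ++ m) ≡ take k l
take-++ zero    l       m _         = refl
take-++ (suc k) (x ∷ l) m (s≤s k≤l) = cong (x ∷_) (take-++ k l m k≤l)

drop-++ : ∀ k (l m : List ℕ) → k ≤ length l → drop k (l ++ m) ≡ drop k l ++ m
drop-++ zero    l       m _         = refl
drop-++ (suc k) (x ∷ l) m (s≤s k≤l) = drop-++ k l m k≤l

sum-map-replicate : ∀ (g : ℕ → ℕ) C x → sum (map g (replicate C x)) ≡ C * g x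
sum-map-replicate g zero    x = refl
sum-map-replicate g (suc C) x = cong (g x +_) (sum-map-replicate g C x)

sum-replicate : ∀ C x → sum (replicate C x) ≡ C * x
sum-replicate zero    x = refl
sum-replicate (suc C) x = cong (x +_) (sum-replicate C x)

entry-∷ : ∀ x l i → 1 ≤ i → entry (x ∷ l) (suc i) ≡ entry l i
entry-∷ x l (suc i) _ = refl

∑-entry-∷ : ∀ (g : ℕ → ℕ) x l a n → ∑ (λ i → g (entry l i)) a n ≡ ∑ (λ i → g (entry (x ∷ l) i)) (suc a) n
∑-entry-∷ g x l a n = trans (∑-cong _ _ a n (λ i a<i _ → cong g (sym (entry-∷ x l i (≤-trans (s≤s z≤n) a<i)))))
                            (sym (∑-shift (λ i → g (entry (x ∷ l) i)) a n))

sum-take : ∀ l k → sum (take k l) ≡ ∑ (entry l) 0 k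
sum-take []      zero    = refl
sum-take []      (suc k) = sym (∑-zero 1 k)
sum-take (x ∷ l) zero    = refl
sum-take (x ∷ l) (suc k) = cong (x +_) (trans (sum-take l k) (∑-entry-∷ id x l 0 k))

sum-map-drop : ∀ l k (g : ℕ → ℕ) → sum (map g (drop k l)) ≡ ∑ (λ i → g (entry l i)) k (length l ∸ k)
sum-map-drop []      zero    g = refl
sum-map-drop []      (suc k) g = refl
sum-map-drop (x ∷ l) zero    g = cong (g x +_) (trans (sum-map-drop l zero g) (∑-entry-∷ g x l 0 (length l)))
sum-map-drop (x ∷ l) (suc k) g = trans (sum-map-drop l k g) (∑-entry-∷ g x l k (length l ∸ k))

sum≡egLeft : ∀ l → sum l ≡ egLeft (entry l) (length l)
sum≡egLeft l = trans (cong sum (sym (take-all (length l) l ≤-refl))) (sum-take l (length l))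

Δ≡egRight-egLeft : ∀ l k → Δ l k ≡ ℤ.+ egRight (length l) (entry l) k ℤ.- ℤ.+ egLeft (entry l) k
Δ≡egRight-egLeft l k = cong₂ (λ a b → ℤ.+ (k * (k ∸ 1) + a) ℤ.- ℤ.+ b) (sum-map-drop l k (k ⊓_)) (sum-take l k)

0≤Δ⇒ErdősGallai : ∀ l k → ℤ.0ℤ ℤ.≤ Δ l k → egLeft (entry l) k ≤ egRight (length l) (entry l) k
0≤Δ⇒ErdősGallai l k 0≤Δ = ℤP.drop‿+≤+ (ℤP.0≤i-j⇒j≤i (subst (ℤ.0ℤ ℤ.≤_) (Δ≡egRight-egLeft l k) 0≤Δ))

Δ-++-replicate : ∀ (l : List ℕ) C x k → k ≤ length l → Δ (l ++ replicate C x) k ≡ Δ l k ℤ.+ ℤ.+ (C * (k ⊓ x))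
Δ-++-replicate l C x k k≤l = begin
  ℤ.+ (k * (k ∸ 1) + sum (map (k ⊓_) (drop k (l ++ replicate C x)))) ℤ.- ℤ.+ sum (take k (l ++ replicate C x))
    ≡⟨ cong₂ (λ u v → ℤ.+ (k * (k ∸ 1) + u) ℤ.- ℤ.+ sum v) tail≡ (take-++ k l _ k≤l) ⟩
  ℤ.+ (k * (k ∸ 1) + (R + B)) ℤ.- ℤ.+ L   ≡⟨ cong (λ u → ℤ.+ u ℤ.- ℤ.+ L) (sym (+-assoc (k * (k ∸ 1)) R B)) ⟩
  ℤ.+ (A + B) ℤ.- ℤ.+ L                   ≡⟨ cong (ℤ._- ℤ.+ L) (ℤP.pos-+ A B) ⟩
  (ℤ.+ A ℤ.+ ℤ.+ B) ℤ.- ℤ.+ L             ≡⟨ regroup (ℤ.+ A) (ℤ.+ B) (ℤ.+ L) ⟩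
  (ℤ.+ A ℤ.- ℤ.+ L) ℤ.+ ℤ.+ B             ∎
  where
  open ≡-Reasoning
  R = sum (map (k ⊓_) (drop k l))
  A = k * (k ∸ 1) + R
  B = C * (k ⊓ x)
  L = sum (take k l)
  tail≡ : sum (map (k ⊓_) (drop k (l ++ replicate C x))) ≡ R + B
  tail≡ = begin
    sum (map (k ⊓_) (drop k (l ++ replicate C x)))                ≡⟨ cong (λ u → sum (map (k ⊓_) u)) (drop-++ k l _ k≤l) ⟩
    sum (map (k ⊓_) (drop k l ++ replicate C x))                  ≡⟨ cong sum (map-++ (k ⊓_) (drop k l) (replicate C x)) ⟩
    sum (map (k ⊓_) (drop k l) ++ map (k ⊓_) (replicate C x))     ≡⟨ sum-++ (map (k ⊓_) (drop k l)) _ ⟩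
    R + sum (map (k ⊓_) (replicate C x))                          ≡⟨ cong (R +_) (sum-map-replicate (k ⊓_) C x) ⟩
    R + B                                                         ∎
  regroup : ∀ a b c → (a ℤ.+ b) ℤ.- c ≡ (a ℤ.- c) ℤ.+ b
  regroup = ℤ-Solver.solve-∀

range1≡applyUpTo : ∀ n → range1 n ≡ applyUpTo suc n
range1≡applyUpTo n = map-upTo suc n

range1-suc : ∀ n → range1 (suc n) ≡ range1 n ++ (suc n ∷ [])
range1-suc n = trans (cong (map suc) (sym (upTo-∷ʳ n))) (map-++ suc (upTo n) (n ∷ []))

length-range1 : ∀ n → length (range1 n) ≡ n
length-range1 n = trans (cong length (range1≡applyUpTo n)) (length-applyUpTo suc n)

entry-map-range1 : ∀ (d : ℕ → ℕ) n i → 1 ≤ i → i ≤ n → entry (map d (range1 n)) i ≡ d i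
entry-map-range1 d n (suc i) _ i<n = trans (nth-map d (range1 n) i (subst (i <_) (sym (length-range1 n)) i<n))
  (cong d (trans (cong (λ z → nth z i) (range1≡applyUpTo n)) (nth-applyUpTo suc n i i<n)))

lookup≡nth : ∀ l k → lookup l k ≡ nth l (toℕ k)
lookup≡nth (x ∷ l) Fin.zero    = refl
lookup≡nth (x ∷ l) (Fin.suc k) = lookup≡nth l k

sum-tabulate : ∀ n (h : Fin n → ℕ) (g : ℕ → ℕ) → (∀ j → h j ≡ g (suc (toℕ j))) → sum (tabulate h) ≡ ∑ g 0 n
sum-tabulate zero    h g h≡g = refl
sum-tabulate (suc n) h g h≡g = cong₂ _+_ (h≡g Fin.zero)
  (trans (sum-tabulate n (λ j → h (Fin.suc j)) (λ i → g (suc i)) (λ j → h≡g (Fin.suc j))) (sym (∑-shift g 0 n)))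

if-then-1-else-0 : ∀ b → (if b then 1 else 0) ≡ bit b
if-then-1-else-0 true  = refl
if-then-1-else-0 false = refl

degree≡∑ : ∀ {p} (adj : Fin p → Fin p → Bool) k (g : ℕ → ℕ) → (∀ j → bit (adj k j) ≡ g (suc (toℕ j))) →
           degree adj k ≡ ∑ g 0 p
degree≡∑ {p} adj k g adj≡g = trans (cong sum (map-tabulate id (λ j → if adj k j then 1 else 0)))
  (sum-tabulate p _ g (λ j → trans (if-then-1-else-0 (adj k j)) (adj≡g j)))

graphicOn⇒Graphic : ∀ l → GraphicOn (length l) (entry l) → Graphic l
graphicOn⇒Graphic l (A , (sym-A , loopless) , R) = adj , ((λ i j → sym-A _ _) , (λ i → loopless _)) , degrees
  where
  adj : Fin (length l) → Fin (length l) → Bool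
  adj a b = A (suc (toℕ a)) (suc (toℕ b))
  degrees : ∀ k → degree adj k ≡ lookup l k
  degrees k = trans (degree≡∑ adj k (λ j → bit (A (suc (toℕ k)) j)) (λ j → refl))
                    (trans (R (suc (toℕ k)) (s≤s z≤n) (toℕ<n k)) (sym (lookup≡nth l k)))

toFin : ∀ p → ℕ → Maybe (Fin p)
toFin zero    _       = nothing
toFin (suc p) zero    = just Fin.zero
toFin (suc p) (suc i) = Maybe.map Fin.suc (toFin p i)

toFin-toℕ : ∀ {p} (k : Fin p) → toFin p (toℕ k) ≡ just k
toFin-toℕ {suc p} Fin.zero    = refl
toFin-toℕ {suc p} (Fin.suc k) = cong (Maybe.map Fin.suc) (toFin-toℕ k)

Graphic⇒graphicOn : ∀ l → Graphic l → GraphicOn (length l) (entry l)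
Graphic⇒graphicOn l (adj , (sym-adj , loopless) , degrees) =
  A , ((λ i j → symmetric (vertex i) (vertex j)) , (λ i → irreflexive (vertex i))) , R
  where
  p = length l
  adjᴹ : Maybe (Fin p) → Maybe (Fin p) → Bool
  adjᴹ (just a) (just b) = adj a b
  adjᴹ _        _        = false
  vertex : ℕ → Maybe (Fin p)
  vertex i = toFin p (i ∸ 1)
  A : ℕ → ℕ → Bool
  A i j = adjᴹ (vertex i) (vertex j)
  symmetric : ∀ u v → adjᴹ u v ≡ adjᴹ v u
  symmetric (just a) (just b) = sym-adj a b
  symmetric (just a) nothing  = refl
  symmetric nothing  (just b) = refl
  symmetric nothing  nothing  = refl
  irreflexive : ∀ u → adjᴹ u u ≡ false
  irreflexive (just a) = loopless a
  irreflexive nothing  = refl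
  R : Realises p A (entry l)
  R (suc i) _ i<p = begin
    deg p A (suc i)   ≡⟨ sym (degree≡∑ adj k _ (λ j → cong bit (sym (cong₂ adjᴹ vertex≡ (toFin-toℕ j))))) ⟩
    degree adj k      ≡⟨ degrees k ⟩
    lookup l k        ≡⟨ lookup≡nth l k ⟩
    nth l (toℕ k)     ≡⟨ cong (nth l) (toℕ-fromℕ< i<p) ⟩
    nth l i           ∎
    where
    open ≡-Reasoning
    k : Fin p
    k = fromℕ< i<p
    vertex≡ : vertex (suc i) ≡ just k
    vertex≡ = trans (cong (toFin p) (sym (toℕ-fromℕ< i<p))) (toFin-toℕ k)

Graphic⇒0≤Δ : ∀ l → Graphic l → ∀ k → 1 ≤ k → k ≤ length l → ℤ.0ℤ ℤ.≤ Δ l k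
Graphic⇒0≤Δ l g k 1≤k k≤l with Graphic⇒graphicOn l g
... | A , G , R = subst (ℤ.0ℤ ℤ.≤_) (sym (Δ≡egRight-egLeft l k))
                        (ℤP.i≤j⇒0≤j-i (ℤ.+≤+ (realises⇒ErdősGallai (length l) A (entry l) G R k 1≤k k≤l)))

Graphic⇒even : ∀ l → Graphic l → 2 ∣ sum l
Graphic⇒even l g with Graphic⇒graphicOn l g
... | A , G , R = subst (2 ∣_) (sym (sum≡egLeft l)) (realises⇒even (length l) A (entry l) G R)

Δ-head≤0 : ∀ l → length l ∸ 1 ≤ entry l 1 → Δ l 1 ℤ.≤ ℤ.0ℤ
Δ-head≤0 l len∸1≤ = subst (ℤ._≤ ℤ.0ℤ) (sym (Δ≡egRight-egLeft l 1)) (ℤP.i≤j⇒i-j≤0 (ℤ.+≤+ (begin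
  ∑ (λ i → 1 ⊓ entry l i) 1 (length l ∸ 1)
    ≤⟨ ∑-mono-≤ _ (λ _ → 1) 1 (length l ∸ 1) (λ i _ _ → m⊓n≤m 1 (entry l i)) ⟩
  ∑ (λ _ → 1) 1 (length l ∸ 1)              ≡⟨ ∑-one 1 (length l ∸ 1) ⟩
  length l ∸ 1                              ≤⟨ len∸1≤ ⟩
  entry l 1                                 ≡⟨ sym (+-identityʳ _) ⟩
  egLeft (entry l) 1                        ∎)))
  where open ≤-Reasoning

-- Ceilings

ceilDiv*≡ : ∀ a b → ceilDiv a (suc b) ℤ.* ℤ.+ suc b ≡ a ℤ.+ ℤ.+ ((- a) %ℕ suc b)
ceilDiv*≡ a b = begin
  (- q) ℤ.* ℤ.+ m                     ≡⟨ regroup q (ℤ.+ m) (ℤ.+ r) ⟩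
  - (ℤ.+ r ℤ.+ q ℤ.* ℤ.+ m) ℤ.+ ℤ.+ r ≡⟨ cong (λ z → - z ℤ.+ ℤ.+ r) (sym (a≡a%ℕn+[a/ℕn]*n (- a) m)) ⟩
  - - a ℤ.+ ℤ.+ r                     ≡⟨ cong (ℤ._+ ℤ.+ r) (ℤP.neg-involutive a) ⟩
  a ℤ.+ ℤ.+ r                         ∎
  where
  open ≡-Reasoning
  m = suc b
  q = (- a) /ℕ m
  r = (- a) %ℕ m
  regroup : ∀ q M R → (- q) ℤ.* M ≡ - (R ℤ.+ q ℤ.* M) ℤ.+ R
  regroup = ℤ-Solver.solve-∀

≤ceilDiv* : ∀ a m → 1 ≤ m → a ℤ.≤ ceilDiv a m ℤ.* ℤ.+ m
≤ceilDiv* a (suc b) _ = subst (a ℤ.≤_) (sym (ceilDiv*≡ a b)) (ℤP.i≤i+j a _)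

ceilDiv*< : ∀ a m → 1 ≤ m → ceilDiv a m ℤ.* ℤ.+ m ℤ.< a ℤ.+ ℤ.+ m
ceilDiv*< a (suc b) _ = subst (ℤ._< a ℤ.+ ℤ.+ suc b) (sym (ceilDiv*≡ a b)) (ℤP.+-monoʳ-< a (ℤ.+<+ (n%ℕd<d (- a) (suc b))))

ceilDiv-least : ∀ a m z → 1 ≤ m → a ℤ.≤ z ℤ.* ℤ.+ m → ceilDiv a m ℤ.≤ z
ceilDiv-least a m z 1≤m a≤zm = subst (ceilDiv a m ℤ.≤_) (ℤP.pred-suc z) (ℤP.i<j⇒i≤pred[j] c<1+z)
  where
  open ℤP.≤-Reasoning
  regroup : ∀ z M → z ℤ.* M ℤ.+ M ≡ (ℤ.1ℤ ℤ.+ z) ℤ.* M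
  regroup = ℤ-Solver.solve-∀
  c<1+z : ceilDiv a m ℤ.< ℤ.1ℤ ℤ.+ z
  c<1+z = ℤP.*-cancelʳ-<-nonNeg (ℤ.+ m) (begin-strict
    ceilDiv a m ℤ.* ℤ.+ m    <⟨ ceilDiv*< a m 1≤m ⟩
    a ℤ.+ ℤ.+ m              ≤⟨ ℤP.+-monoˡ-≤ (ℤ.+ m) a≤zm ⟩
    z ℤ.* ℤ.+ m ℤ.+ ℤ.+ m    ≡⟨ regroup z (ℤ.+ m) ⟩
    (ℤ.1ℤ ℤ.+ z) ℤ.* ℤ.+ m   ∎)

ceilDiv≤⇔ : ∀ D m C → 1 ≤ m → (ceilDiv (- D) m ℤ.≤ ℤ.+ C → ℤ.0ℤ ℤ.≤ D ℤ.+ ℤ.+ (C * m))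
                              × (ℤ.0ℤ ℤ.≤ D ℤ.+ ℤ.+ (C * m) → ceilDiv (- D) m ℤ.≤ ℤ.+ C)
ceilDiv≤⇔ D m C 1≤m = to , from
  where
  shift : ℤ.+ (C * m) ℤ.- (- D) ≡ D ℤ.+ ℤ.+ (C * m)
  shift = regroup D (ℤ.+ (C * m))
    where
    regroup : ∀ D X → X ℤ.- (- D) ≡ D ℤ.+ X
    regroup = ℤ-Solver.solve-∀
  to : ceilDiv (- D) m ℤ.≤ ℤ.+ C → ℤ.0ℤ ℤ.≤ D ℤ.+ ℤ.+ (C * m)
  to c≤C = subst (ℤ.0ℤ ℤ.≤_) shift (ℤP.i≤j⇒0≤j-i (subst (- D ℤ.≤_) (sym (ℤP.pos-* C m))
             (ℤP.≤-trans (≤ceilDiv* (- D) m 1≤m) (ℤP.*-monoʳ-≤-nonNeg (ℤ.+ m) c≤C))))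
  from : ℤ.0ℤ ℤ.≤ D ℤ.+ ℤ.+ (C * m) → ceilDiv (- D) m ℤ.≤ ℤ.+ C
  from 0≤ = ceilDiv-least (- D) m (ℤ.+ C) 1≤m
              (subst (- D ℤ.≤_) (ℤP.pos-* C m) (ℤP.0≤i-j⇒j≤i (subst (ℤ.0ℤ ℤ.≤_) (sym shift) 0≤)))

+ceilDiv*< : ∀ D m e → 1 ≤ m → D ℤ.+ (ceilDiv (- D) m ℤ.+ ℤ.+ e) ℤ.* ℤ.+ m ℤ.< ℤ.+ (suc e * m)
+ceilDiv*< D m e 1≤m = begin-strict
  D ℤ.+ (c ℤ.+ ℤ.+ e) ℤ.* ℤ.+ m                  ≡⟨ regroup₁ D c (ℤ.+ e) (ℤ.+ m) ⟩
  c ℤ.* ℤ.+ m ℤ.+ (D ℤ.+ ℤ.+ e ℤ.* ℤ.+ m)        <⟨ ℤP.+-monoˡ-< (D ℤ.+ ℤ.+ e ℤ.* ℤ.+ m) (ceilDiv*< (- D) m 1≤m) ⟩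
  (- D ℤ.+ ℤ.+ m) ℤ.+ (D ℤ.+ ℤ.+ e ℤ.* ℤ.+ m)    ≡⟨ regroup₂ D (ℤ.+ e) (ℤ.+ m) ⟩
  ℤ.+ m ℤ.+ ℤ.+ e ℤ.* ℤ.+ m                      ≡⟨ cong (λ z → ℤ.+ m ℤ.+ z) (sym (ℤP.pos-* e m)) ⟩
  ℤ.+ m ℤ.+ ℤ.+ (e * m)                          ≡⟨ sym (ℤP.pos-+ m (e * m)) ⟩
  ℤ.+ (suc e * m)                                ∎
  where
  open ℤP.≤-Reasoning
  c = ceilDiv (- D) m
  regroup₁ : ∀ D c E M → D ℤ.+ (c ℤ.+ E) ℤ.* M ≡ c ℤ.* M ℤ.+ (D ℤ.+ E ℤ.* M)
  regroup₁ = ℤ-Solver.solve-∀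
  regroup₂ : ∀ D E M → (- D ℤ.+ M) ℤ.+ (D ℤ.+ E ℤ.* M) ≡ M ℤ.+ E ℤ.* M
  regroup₂ = ℤ-Solver.solve-∀

-- Extending a sequence by copies of its last entry

entry-++ˡ : ∀ s m i → 1 ≤ i → i ≤ length s → entry (s ++ m) i ≡ entry s i
entry-++ˡ s m (suc i) _ i<s = nth-++ˡ s m i i<s

entry-++-replicate : ∀ s C x i → length s < i → i ≤ length (s ++ replicate C x) → entry (s ++ replicate C x) i ≡ x
entry-++-replicate s C x (suc i) s<i+1 i<s+C = begin
  nth (s ++ replicate C x) i                      ≡⟨ cong (nth (s ++ replicate C x)) (sym (m+[n∸m]≡n s≤i)) ⟩
  nth (s ++ replicate C x) (length s + (i ∸ length s)) ≡⟨ nth-++ʳ s (replicate C x) (i ∸ length s) ⟩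
  nth (replicate C x) (i ∸ length s)              ≡⟨ nth-replicate C x (i ∸ length s) i∸s<C ⟩
  x                                               ∎
  where
  open ≡-Reasoning
  s≤i = s≤s⁻¹ s<i+1
  i∸s<C : i ∸ length s < C
  i∸s<C = +-cancelˡ-< (length s) (i ∸ length s) C
    (subst₂ _<_ (sym (m+[n∸m]≡n s≤i)) (trans (length-++ s) (cong (length s +_) (length-replicate C))) i<s+C)

sorted-++-replicate : ∀ s C x → Sorted (length s) (entry s) → 1 ≤ length s → entry s (length s) ≡ x →
                      Sorted (length (s ++ replicate C x)) (entry (s ++ replicate C x))
sorted-++-replicate s C x sorted 1≤s last = sorted-adjacent _ _ step
  where
  sb = s ++ replicate C x
  step : ∀ i → 1 ≤ i → i < length sb → entry sb (suc i) ≤ entry sb i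
  step i 1≤i i<sb with suc i ≤? length s
  ... | yes i<s = subst₂ _≤_ (sym (entry-++ˡ s _ (suc i) (s≤s z≤n) i<s)) (sym (entry-++ˡ s _ i 1≤i (<⇒≤ i<s)))
                          (sorted i (suc i) 1≤i (n≤1+n i) i<s)
  ... | no  i≮s = subst (_≤ entry sb i) (sym (entry-++-replicate s C x (suc i) (≰⇒> i≮s) i<sb)) x≤
    where
    x≤ : x ≤ entry sb i
    x≤ with i ≤? length s
    ... | yes i≤s = ≤-reflexive (sym (trans (entry-++ˡ s _ i 1≤i i≤s)
                      (trans (cong (entry s) (≤-antisym i≤s (s≤s⁻¹ (≰⇒> i≮s)))) last)))
    ... | no  i≰s = ≤-reflexive (sym (entry-++-replicate s C x i (≰⇒> i≰s) (<⇒≤ i<sb)))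

sum-++-replicate : ∀ s C x → sum (s ++ replicate C x) ≡ sum s + C * x
sum-++-replicate s C x = trans (sum-++ s (replicate C x)) (cong (sum s +_) (sum-replicate C x))

module Extension (s : List ℕ) (x K k⋆ : ℕ) (1≤x : 1 ≤ x) (1≤K : 1 ≤ K) (K<s : K < length s)
                 (sorted : Sorted (length s) (entry s)) (tail : ∀ i → K < i → i ≤ length s → entry s i ≡ x)
                 (head : length s ∸ 1 ≤ entry s 1) (1≤k⋆ : 1 ≤ k⋆) (k⋆≤K : k⋆ ≤ K)
                 (maximal : ∀ k → 1 ≤ k → k ≤ K → ceilDiv (- Δ s k) (k ⊓ x) ℤ.≤ ceilDiv (- Δ s k⋆) (k⋆ ⊓ x)) where

  c : ℤ
  c = ceilDiv (- Δ s k⋆) (k⋆ ⊓ x)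

  private
    K≤s = <⇒≤ K<s
    1≤s = ≤-trans 1≤K K≤s
    1≤⊓x : ∀ k → 1 ≤ k → 1 ≤ k ⊓ x
    1≤⊓x k 1≤k = ⊓-glb 1≤k 1≤x

  -- The bound at k = 1 is already nonnegative, because Δ s 1 ≤ 0.
  0≤c : ℤ.0ℤ ℤ.≤ c
  0≤c = ℤP.≤-trans 0≤c₁ (maximal 1 ≤-refl 1≤K)
    where
    c₁ = ceilDiv (- Δ s 1) (1 ⊓ x)
    c₁*1≡c₁ : c₁ ℤ.* ℤ.+ (1 ⊓ x) ≡ c₁
    c₁*1≡c₁ = trans (cong (λ z → c₁ ℤ.* ℤ.+ z) (m≤n⇒m⊓n≡m 1≤x)) (ℤP.*-identityʳ c₁)
    0≤c₁ : ℤ.0ℤ ℤ.≤ c₁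
    0≤c₁ = subst (ℤ.0ℤ ℤ.≤_) c₁*1≡c₁
      (ℤP.≤-trans (ℤP.neg-mono-≤ (Δ-head≤0 s head)) (≤ceilDiv* (- Δ s 1) (1 ⊓ x) (1≤⊓x 1 ≤-refl)))

  c₀ : ℕ
  c₀ = ℤ.∣ c ∣

  +c₀≡c : ℤ.+ c₀ ≡ c
  +c₀≡c = ℤP.0≤i⇒+∣i∣≡i 0≤c

  k⋆≤length : ∀ C → k⋆ ≤ length (s ++ replicate C x)
  k⋆≤length C = ≤-trans (≤-trans k⋆≤K K≤s) (subst (length s ≤_) (sym (length-++ s)) (m≤m+n _ _))

  graphic : ∀ C → c₀ ≤ C → 2 ∣ sum s + C * x → Graphic (s ++ replicate C x)
  graphic C c₀≤C even = graphicOn⇒Graphic sb (erdősGallai p (entry sb) sorted′ (subst (2 ∣_) (sum≡egLeft sb) even′)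
                          (ErdősGallai-constTail p (entry sb) K x 1≤K (≤-trans K≤s s≤p) sorted′ tail′ upToK))
    where
    sb = s ++ replicate C x
    p = length sb
    s≤p : length s ≤ p
    s≤p = subst (length s ≤_) (sym (length-++ s)) (m≤m+n _ _)
    even′ : 2 ∣ sum sb
    even′ = subst (2 ∣_) (sym (sum-++-replicate s C x)) even
    sorted′ : Sorted p (entry sb)
    sorted′ = sorted-++-replicate s C x sorted 1≤s (tail (length s) K<s ≤-refl)
    tail′ : ∀ i → K < i → i ≤ p → entry sb i ≡ x
    tail′ i K<i i≤p with i ≤? length s
    ... | yes i≤s = trans (entry-++ˡ s _ i (≤-trans (s≤s z≤n) K<i) i≤s) (tail i K<i i≤s)
    ... | no  i≰s = entry-++-replicate s C x i (≰⇒> i≰s) i≤p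
    upToK : ∀ k → 1 ≤ k → k ≤ K → egLeft (entry sb) k ≤ egRight p (entry sb) k
    upToK k 1≤k k≤K = 0≤Δ⇒ErdősGallai sb k (subst (ℤ.0ℤ ℤ.≤_) (sym (Δ-++-replicate s C x k (≤-trans k≤K K≤s)))
      (proj₁ (ceilDiv≤⇔ (Δ s k) (k ⊓ x) C (1≤⊓x k 1≤k))
             (ℤP.≤-trans (maximal k 1≤k k≤K) (subst (ℤ._≤ ℤ.+ C) +c₀≡c (ℤ.+≤+ c₀≤C)))))

  least : ∀ C → Graphic (s ++ replicate C x) → c₀ ≤ C
  least C g = ℤP.drop‿+≤+ (subst (ℤ._≤ ℤ.+ C) (sym +c₀≡c)
    (proj₂ (ceilDiv≤⇔ (Δ s k⋆) (k⋆ ⊓ x) C (1≤⊓x k⋆ 1≤k⋆))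
      (subst (ℤ.0ℤ ℤ.≤_) (Δ-++-replicate s C x k⋆ (≤-trans k⋆≤K K≤s)) (Graphic⇒0≤Δ _ g k⋆ 1≤k⋆ (k⋆≤length C)))))

  Δ-bound : ∀ e → Δ (s ++ replicate (e + c₀) x) k⋆ ℤ.< ℤ.+ (suc e * x)
  Δ-bound e = begin-strict
    Δ (s ++ replicate (e + c₀) x) k⋆             ≡⟨ Δ-++-replicate s (e + c₀) x k⋆ (≤-trans k⋆≤K K≤s) ⟩
    Δ s k⋆ ℤ.+ ℤ.+ ((e + c₀) * (k⋆ ⊓ x))         ≡⟨ cong (λ z → Δ s k⋆ ℤ.+ z) (ℤP.pos-* (e + c₀) (k⋆ ⊓ x)) ⟩
    Δ s k⋆ ℤ.+ ℤ.+ (e + c₀) ℤ.* ℤ.+ (k⋆ ⊓ x)     ≡⟨ cong (λ z → Δ s k⋆ ℤ.+ z ℤ.* ℤ.+ (k⋆ ⊓ x)) e+c₀≡ ⟩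
    Δ s k⋆ ℤ.+ (c ℤ.+ ℤ.+ e) ℤ.* ℤ.+ (k⋆ ⊓ x)    <⟨ +ceilDiv*< (Δ s k⋆) (k⋆ ⊓ x) e (1≤⊓x k⋆ 1≤k⋆) ⟩
    ℤ.+ (suc e * (k⋆ ⊓ x))                       ≤⟨ ℤ.+≤+ (*-monoʳ-≤ (suc e) (m⊓n≤n k⋆ x)) ⟩
    ℤ.+ (suc e * x)                              ∎
    where
    open ℤP.≤-Reasoning
    e+c₀≡ : ℤ.+ (e + c₀) ≡ c ℤ.+ ℤ.+ e
    e+c₀≡ = trans (ℤP.pos-+ e c₀) (trans (ℤP.+-comm (ℤ.+ e) (ℤ.+ c₀)) (cong (ℤ._+ ℤ.+ e) +c₀≡c))

-- The two cases of the proposition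

2∣n⊎2∣1+n : ∀ n → 2 ∣ n ⊎ 2 ∣ suc n
2∣n⊎2∣1+n zero    = inj₁ (divides 0 refl)
2∣n⊎2∣1+n (suc n) with 2∣n⊎2∣1+n n
... | inj₁ (divides q e) = inj₂ (divides (suc q) (cong (λ z → suc (suc z)) e))
... | inj₂ 2∣1+n         = inj₁ 2∣1+n

odd+odd-even : ∀ a b → ¬ 2 ∣ a → ¬ 2 ∣ b → 2 ∣ a + b
odd+odd-even a b 2∤a 2∤b with 2∣n⊎2∣1+n a | 2∣n⊎2∣1+n b
... | inj₁ 2∣a | _        = ⊥-elim (2∤a 2∣a)
... | _        | inj₁ 2∣b = ⊥-elim (2∤b 2∣b)
... | inj₂ 2∣1+a | inj₂ 2∣1+b =
  ∣m+n∣m⇒∣n (subst (2 ∣_) (regroup a b) (∣m∣n⇒∣m+n 2∣1+a 2∣1+b)) (divides 1 refl)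
  where
  regroup : ∀ a b → suc a + suc b ≡ 2 + (a + b)
  regroup = solve-∀

decreasing⇒n≤d₁ : ∀ n (d : ℕ → ℕ) → (∀ i → 1 ≤ i → i < n → d (suc i) < d i) → 1 ≤ d n → 1 ≤ n → n ≤ d 1
decreasing⇒n≤d₁ (suc m) d decreasing 1≤dn _ = subst (λ z → suc m ≤ d z) (m+n∸n≡m 1 m) (bound m ≤-refl)
  where
  n = suc m
  bound : ∀ j → j < n → suc j ≤ d (n ∸ j)
  bound zero    _   = 1≤dn
  bound (suc j) j<n = <-≤-trans (subst (λ z → suc j < suc (d z)) (sym n∸j≡) (s≤s (bound j (<-trans (n<1+n j) j<n))))
                                 (decreasing (n ∸ suc j) (m<n⇒0<n∸m j<n) (subst (_≤ n) (sym n∸j≡) (m∸n≤m n j)))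
    where
    n∸j≡ : suc (n ∸ suc j) ≡ n ∸ j
    n∸j≡ = sym (m∸n≡suc[m∸suc[n]] (<-trans (n<1+n j) j<n))

module PartA (K : ℕ) (d : ℕ → ℕ) (decreasing : ∀ i → 1 ≤ i → i < suc K → d (suc i) < d i) (1≤x : 1 ≤ d (suc K))
             (1≤K : 1 ≤ K) (k⋆ : ℕ) (1≤k⋆ : 1 ≤ k⋆) (k⋆≤K : k⋆ ≤ K)
             (maximal : ∀ k → 1 ≤ k → k ≤ K →
                ceilDiv (- Δ (map d (range1 (suc K))) k) (k ⊓ d (suc K))
                  ℤ.≤ ceilDiv (- Δ (map d (range1 (suc K))) k⋆) (k⋆ ⊓ d (suc K))) where
  n = suc K
  x = d n
  s = map d (range1 n)
  σ = sum s
  l = map d (range1 K)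

  length-s : length s ≡ n
  length-s = trans (length-map d (range1 n)) (length-range1 n)

  entry-s : ∀ i → 1 ≤ i → i ≤ n → entry s i ≡ d i
  entry-s = entry-map-range1 d n

  sorted-s : Sorted (length s) (entry s)
  sorted-s = subst (λ z → Sorted z (entry s)) (sym length-s) (sorted-adjacent n (entry s) (λ i 1≤i i<n →
    subst₂ _≤_ (sym (entry-s (suc i) (s≤s z≤n) i<n)) (sym (entry-s i 1≤i (<⇒≤ i<n))) (<⇒≤ (decreasing i 1≤i i<n))))

  tail-s : ∀ i → K < i → i ≤ length s → entry s i ≡ x
  tail-s i K<i i≤s = trans (cong (entry s) (≤-antisym (subst (i ≤_) length-s i≤s) K<i)) (entry-s n (s≤s z≤n) ≤-refl)

  head-s : length s ∸ 1 ≤ entry s 1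
  head-s = subst₂ (λ u v → u ∸ 1 ≤ v) (sym length-s) (sym (entry-s 1 ≤-refl (s≤s z≤n)))
                  (≤-trans (n≤1+n K) (decreasing⇒n≤d₁ n d decreasing 1≤x (s≤s z≤n)))

  open Extension s x K k⋆ 1≤x 1≤K (subst (K <_) (sym length-s) ≤-refl) sorted-s tail-s head-s 1≤k⋆ k⋆≤K maximal

  l++≡s++ : ∀ C → l ++ replicate (suc C) x ≡ s ++ replicate C x
  l++≡s++ C = sym (trans (cong (_++ replicate C x) s≡) (++-assoc l (x ∷ []) (replicate C x)))
    where
    s≡ : s ≡ l ++ (x ∷ [])
    s≡ = trans (cong (map d) (range1-suc K)) (map-++ d (range1 K) (suc K ∷ []))

  graphicA : ∀ C → c₀ ≤ C → 2 ∣ σ + C * x → Graphic (l ++ replicate (suc C) x)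
  graphicA C c₀≤C even = subst Graphic (sym (l++≡s++ C)) (graphic C c₀≤C even)

  leastA : ∀ C → Graphic (l ++ replicate (suc C) x) → c₀ ≤ C
  leastA C g = least C (subst Graphic (l++≡s++ C) g)

  Δ-boundA : ∀ e → e ≤ 1 → Δ (l ++ replicate (suc (e + c₀)) x) k⋆ ℤ.< ℤ.+ (2 * x)
  Δ-boundA e e≤1 = ℤP.<-≤-trans (subst (λ z → Δ z k⋆ ℤ.< ℤ.+ (suc e * x)) (sym (l++≡s++ (e + c₀))) (Δ-bound e))
                                (ℤ.+≤+ (*-monoˡ-≤ x (s≤s e≤1)))

  σ+c*x≡ : ℤ.+ σ ℤ.+ c ℤ.* ℤ.+ x ≡ ℤ.+ (σ + c₀ * x)
  σ+c*x≡ = trans (cong (λ z → ℤ.+ σ ℤ.+ z ℤ.* ℤ.+ x) (sym +c₀≡c))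
                 (trans (cong (λ z → ℤ.+ σ ℤ.+ z) (sym (ℤP.pos-* c₀ x))) (sym (ℤP.pos-+ σ (c₀ * x))))

  result : (2 ∣ σ) ⊎ ¬ (2 ∣ x) →
    Σ ℕ λ C →
      Graphic (l ++ replicate (suc C) x) ×
      (∀ C′ → Graphic (l ++ replicate (suc C′) x) → C ≤ C′) ×
      ((2 ∣ x) → (2 ∣ σ) → ℤ.+ C ≡ c) ×
      (¬ (2 ∣ x) → (ℤ.+ 2 ∣ℤ (ℤ.+ σ ℤ.+ c ℤ.* ℤ.+ x)) → ℤ.+ C ≡ c) ×
      (¬ (2 ∣ x) → ¬ (ℤ.+ 2 ∣ℤ (ℤ.+ σ ℤ.+ c ℤ.* ℤ.+ x)) → ℤ.+ C ≡ c ℤ.+ ℤ.+ 1) ×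
      (Δ (l ++ replicate (suc C) x) k⋆ ℤ.< ℤ.+ (2 * x))
  result parity with 2 ∣? x
  ... | yes 2∣x =
    c₀ , graphicA c₀ ≤-refl (∣m∣n⇒∣m+n 2∣σ (∣n⇒∣m*n c₀ 2∣x)) , leastA ,
    (λ _ _ → +c₀≡c) , (λ 2∤x → ⊥-elim (2∤x 2∣x)) , (λ 2∤x → ⊥-elim (2∤x 2∣x)) , Δ-boundA 0 z≤n
    where
    2∣σ : 2 ∣ σ
    2∣σ = [ id , (λ 2∤x → ⊥-elim (2∤x 2∣x)) ] parity
  ... | no 2∤x with 2 ∣? (σ + c₀ * x)
  ...   | yes 2∣σ+c₀x =
    c₀ , graphicA c₀ ≤-refl 2∣σ+c₀x , leastA ,
    (λ 2∣x → ⊥-elim (2∤x 2∣x)) , (λ _ _ → +c₀≡c) ,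
    (λ _ 2∤σ+cx → ⊥-elim (2∤σ+cx (subst (ℤ.+ 2 ∣ℤ_) (sym σ+c*x≡) 2∣σ+c₀x))) , Δ-boundA 0 z≤n
  ...   | no 2∤σ+c₀x =
    suc c₀ , graphicA (suc c₀) (n≤1+n c₀) 2∣σ+[1+c₀]x , minimal ,
    (λ 2∣x → ⊥-elim (2∤x 2∣x)) , (λ _ 2∣σ+cx → ⊥-elim (2∤σ+c₀x (subst (ℤ.+ 2 ∣ℤ_) σ+c*x≡ 2∣σ+cx))) ,
    (λ _ _ → 1+c₀≡c+1) , Δ-boundA 1 ≤-refl
    where
    2∣σ+[1+c₀]x : 2 ∣ σ + suc c₀ * x
    2∣σ+[1+c₀]x = subst (2 ∣_) (regroup σ c₀ x) (odd+odd-even (σ + c₀ * x) x 2∤σ+c₀x 2∤x)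
      where
      regroup : ∀ σ c x → (σ + c * x) + x ≡ σ + suc c * x
      regroup = solve-∀
    1+c₀≡c+1 : ℤ.+ suc c₀ ≡ c ℤ.+ ℤ.+ 1
    1+c₀≡c+1 = trans (cong ℤ.+_ (+-comm 1 c₀)) (trans (ℤP.pos-+ c₀ 1) (cong (ℤ._+ ℤ.+ 1) +c₀≡c))
    -- the parity of the degree sum rules out C = c₀
    minimal : ∀ C′ → Graphic (l ++ replicate (suc C′) x) → suc c₀ ≤ C′
    minimal C′ g = ≤∧≢⇒< (leastA C′ g) c₀≢C′
      where
      c₀≢C′ : ¬ c₀ ≡ C′
      c₀≢C′ refl = 2∤σ+c₀x (subst (2 ∣_) (sum-++-replicate s c₀ x) (Graphic⇒even _ (subst Graphic (l++≡s++ c₀) g)))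

module PartB (K : ℕ) (d : ℕ → ℕ) (decreasing : ∀ i → 1 ≤ i → i < suc K → d (suc i) < d i) (1≤x : 1 ≤ d (suc K))
             (2∤σ : ¬ (2 ∣ sum (map d (range1 (suc K))))) (2∣x : 2 ∣ d (suc K))
             (r : ℕ) (1≤r : 1 ≤ r) (r≤n : r ≤ suc K) (2∤dr : ¬ (2 ∣ d r))
             (k⋆ : ℕ) (1≤k⋆ : 1 ≤ k⋆) (k⋆≤n : k⋆ ≤ suc K)
             (maximal : ∀ k → 1 ≤ k → k ≤ suc K →
                ceilDiv (- Δ (map d (range1 r) ++ d r ∷ map d (drop r (range1 (suc K)))) k) (k ⊓ d (suc K))
                  ℤ.≤ ceilDiv (- Δ (map d (range1 r) ++ d r ∷ map d (drop r (range1 (suc K)))) k⋆) (k⋆ ⊓ d (suc K))) where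
  n = suc K
  x = d n
  σ = sum (map d (range1 n))
  before = map d (range1 r)
  after = map d (drop r (range1 n))
  s = before ++ d r ∷ after

  private
    length-before : length before ≡ r
    length-before = trans (length-map d (range1 r)) (length-range1 r)

    length-drop-range1 : length (drop r (range1 n)) ≡ n ∸ r
    length-drop-range1 = trans (length-drop r (range1 n)) (cong (_∸ r) (length-range1 n))

    length-after : length after ≡ n ∸ r
    length-after = trans (length-map d (drop r (range1 n))) length-drop-range1

  length-s : length s ≡ suc n
  length-s = trans (length-++ before) (trans (cong₂ (λ u v → u + suc v) length-before length-after)
                   (trans (+-suc r (n ∸ r)) (cong suc (m+[n∸m]≡n r≤n))))

  entry-s-≤r : ∀ i → 1 ≤ i → i ≤ r → entry s i ≡ d i
  entry-s-≤r (suc i) 1≤i i<r = trans (nth-++ˡ before (d r ∷ after) i (subst (i <_) (sym length-before) i<r))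
                                     (entry-map-range1 d r (suc i) 1≤i i<r)

  nth-after : ∀ j → r + suc j ≤ n → nth after j ≡ d (r + suc j)
  nth-after j r+j<n = begin
    nth after j                        ≡⟨ nth-map d (drop r (range1 n)) j (subst (j <_) (sym length-drop-range1) j<n∸r) ⟩
    d (nth (drop r (range1 n)) j)      ≡⟨ cong d (nth-drop r (range1 n) j) ⟩
    d (nth (range1 n) (r + j))         ≡⟨ cong (λ z → d (nth z (r + j))) (range1≡applyUpTo n) ⟩
    d (nth (applyUpTo suc n) (r + j))  ≡⟨ cong d (nth-applyUpTo suc n (r + j) (subst (_≤ n) (+-suc r j) r+j<n)) ⟩
    d (suc (r + j))                    ≡⟨ cong d (sym (+-suc r j)) ⟩
    d (r + suc j)                      ∎
    where
    open ≡-Reasoning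
    j<n∸r : j < n ∸ r
    j<n∸r = +-cancelˡ-< r j (n ∸ r) (subst (_≤ r + (n ∸ r)) (+-suc r j) (subst (r + suc j ≤_) (sym (m+[n∸m]≡n r≤n)) r+j<n))

  entry-s->r : ∀ i → r < i → i ≤ suc n → entry s i ≡ d (i ∸ 1)
  entry-s->r (suc i) r<i i≤n = from (i ∸ r) (m+[n∸m]≡n (s≤s⁻¹ r<i))
    where
    nth-s : ∀ j → nth s (r + j) ≡ nth (d r ∷ after) j
    nth-s j = trans (cong (λ z → nth s (z + j)) (sym length-before)) (nth-++ʳ before (d r ∷ after) j)
    from : ∀ j → r + j ≡ i → nth s i ≡ d i
    from zero    r+0≡i = subst (λ z → nth s z ≡ d z) r+0≡i (trans (nth-s 0) (cong d (sym (+-identityʳ r))))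
    from (suc j) r+j≡i = subst (λ z → nth s z ≡ d z) r+j≡i
      (trans (nth-s (suc j)) (nth-after j (subst (_≤ n) (sym r+j≡i) (s≤s⁻¹ i≤n))))

  r<n : r < n
  r<n = ≤∧≢⇒< r≤n (λ r≡n → 2∤dr (subst (λ z → 2 ∣ d z) (sym r≡n) 2∣x))

  sorted-s : Sorted (length s) (entry s)
  sorted-s = subst (λ z → Sorted z (entry s)) (sym length-s) (sorted-adjacent (suc n) (entry s) step)
    where
    step : ∀ i → 1 ≤ i → i < suc n → entry s (suc i) ≤ entry s i
    step i 1≤i i<n+1 with <-cmp i r
    ... | tri< i<r _ _ = subst₂ _≤_ (sym (entry-s-≤r (suc i) (s≤s z≤n) i<r)) (sym (entry-s-≤r i 1≤i (<⇒≤ i<r)))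
                                (<⇒≤ (decreasing i 1≤i (<-≤-trans i<r r≤n)))
    ... | tri≈ _ refl _ = ≤-reflexive (trans (entry-s->r (suc i) ≤-refl (s≤s (<⇒≤ r<n))) (sym (entry-s-≤r i 1≤i ≤-refl)))
    ... | tri> _ _ r<i = subst₂ _≤_ (sym (entry-s->r (suc i) (<-trans r<i (n<1+n i)) i<n+1)) (sym (entry-s->r i r<i (<⇒≤ i<n+1)))
                                (later i r<i (s≤s⁻¹ i<n+1))
      where
      later : ∀ i → r < i → i ≤ n → d i ≤ d (i ∸ 1)
      later (suc i) r<i i<n = <⇒≤ (decreasing i (≤-trans 1≤r (s≤s⁻¹ r<i)) i<n)

  tail-s : ∀ i → n < i → i ≤ length s → entry s i ≡ x
  tail-s i n<i i≤s = trans (cong (entry s) (≤-antisym (subst (i ≤_) length-s i≤s) n<i))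
                           (entry-s->r (suc n) (<-trans r<n (n<1+n n)) ≤-refl)

  head-s : length s ∸ 1 ≤ entry s 1
  head-s = subst₂ (λ u v → u ∸ 1 ≤ v) (sym length-s) (sym (entry-s-≤r 1 ≤-refl 1≤r))
                  (decreasing⇒n≤d₁ n d decreasing 1≤x (s≤s z≤n))

  sum-s : sum s ≡ σ + d r
  sum-s = begin
    sum s                          ≡⟨ sum-++ before (d r ∷ after) ⟩
    sum before + (d r + sum after) ≡⟨ regroup (sum before) (d r) (sum after) ⟩
    (sum before + sum after) + d r ≡⟨ cong (_+ d r) (sym σ≡) ⟩
    σ + d r                        ∎
    where
    open ≡-Reasoning
    regroup : ∀ a b c → a + (b + c) ≡ (a + c) + b
    regroup = solve-∀
    take≡ : take r (range1 n) ≡ range1 r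
    take≡ = trans (cong (take r) (range1≡applyUpTo n)) (trans (take-applyUpTo suc r n r≤n) (sym (range1≡applyUpTo r)))
    σ≡ : σ ≡ sum before + sum after
    σ≡ = trans (cong (λ z → sum (map d z)) (sym (take++drop≡id r (range1 n))))
           (trans (cong sum (map-++ d (take r (range1 n)) (drop r (range1 n))))
             (trans (sum-++ (map d (take r (range1 n))) after) (cong (λ z → sum (map d z) + sum after) take≡)))

  open Extension s x n k⋆ 1≤x (s≤s z≤n) (subst (n <_) (sym length-s) ≤-refl) sorted-s tail-s head-s 1≤k⋆ k⋆≤n maximal

  result : Σ ℕ λ C →
      Graphic (s ++ replicate C x) ×
      (∀ C′ → Graphic (s ++ replicate C′ x) → C ≤ C′) ×
      (ℤ.+ C ≡ c) ×
      (Δ (s ++ replicate C x) k⋆ ℤ.< ℤ.+ x)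
  result = c₀ , graphic c₀ ≤-refl 2∣sum , least , +c₀≡c ,
           subst (Δ (s ++ replicate c₀ x) k⋆ ℤ.<_) (cong ℤ.+_ (*-identityˡ x)) (Δ-bound 0)
    where
    -- the duplicated odd term d r makes the sum even
    2∣sum : 2 ∣ sum s + c₀ * x
    2∣sum = subst (λ z → 2 ∣ z + c₀ * x) (sym sum-s)
                  (∣m∣n⇒∣m+n (odd+odd-even σ (d r) 2∤σ 2∤dr) (∣n⇒∣m*n c₀ 2∣x))

open import Data.Integer using (+_)

proposition1 :
  (n : ℕ) (d : ℕ → ℕ) →
  1 ≤ n →
  (∀ i → 1 ≤ i → i < n → d (suc i) < d i) →
  1 ≤ d n →
  -- part (a)
  ((2 ≤ n) →
   ((2 ∣ sum (map d (range1 n))) ⊎ ¬ (2 ∣ d n)) →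
   (kstar : ℕ) → 1 ≤ kstar → kstar ≤ n ℕ.∸ 1 →
   (∀ k → 1 ≤ k → k ≤ n ℕ.∸ 1 →
      ceilDiv (- Δ (map d (range1 n)) k) (k ⊓ d n)
        ℤ.≤ ceilDiv (- Δ (map d (range1 n)) kstar) (kstar ⊓ d n)) →
   Σ ℕ λ C →
     Graphic (map d (range1 (n ℕ.∸ 1)) ++ replicate (suc C) (d n)) ×
     (∀ C′ → Graphic (map d (range1 (n ℕ.∸ 1)) ++ replicate (suc C′) (d n)) → C ≤ C′) ×
     ((2 ∣ d n) → (2 ∣ sum (map d (range1 n))) →
        + C ≡ ceilDiv (- Δ (map d (range1 n)) kstar) (kstar ⊓ d n)) ×
     (¬ (2 ∣ d n) →
        (+ 2 ∣ℤ (+ sum (map d (range1 n)) ℤ.+ ceilDiv (- Δ (map d (range1 n)) kstar) (kstar ⊓ d n) ℤ.* + d n)) →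
        + C ≡ ceilDiv (- Δ (map d (range1 n)) kstar) (kstar ⊓ d n)) ×
     (¬ (2 ∣ d n) →
        ¬ (+ 2 ∣ℤ (+ sum (map d (range1 n)) ℤ.+ ceilDiv (- Δ (map d (range1 n)) kstar) (kstar ⊓ d n) ℤ.* + d n)) →
        + C ≡ ceilDiv (- Δ (map d (range1 n)) kstar) (kstar ⊓ d n) ℤ.+ + 1) ×
     (Δ (map d (range1 (n ℕ.∸ 1)) ++ replicate (suc C) (d n)) kstar ℤ.< + (2 ℕ.* d n)))
  ×
  -- part (b)
  (¬ (2 ∣ sum (map d (range1 n))) →
   (2 ∣ d n) →
   (r : ℕ) → 1 ≤ r → r ≤ n → ¬ (2 ∣ d r) → (∀ i → r < i → i ≤ n → 2 ∣ d i) →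
   (kstar : ℕ) → 1 ≤ kstar → kstar ≤ n →
   (∀ k → 1 ≤ k → k ≤ n →
      ceilDiv (- Δ (map d (range1 r) ++ d r ∷ map d (drop r (range1 n))) k) (k ⊓ d n)
        ℤ.≤ ceilDiv (- Δ (map d (range1 r) ++ d r ∷ map d (drop r (range1 n))) kstar) (kstar ⊓ d n)) →
   Σ ℕ λ C →
     Graphic ((map d (range1 r) ++ d r ∷ map d (drop r (range1 n))) ++ replicate C (d n)) ×
     (∀ C′ → Graphic ((map d (range1 r) ++ d r ∷ map d (drop r (range1 n))) ++ replicate C′ (d n)) → C ≤ C′) ×
     (+ C ≡ ceilDiv (- Δ (map d (range1 r) ++ d r ∷ map d (drop r (range1 n))) kstar) (kstar ⊓ d n)) ×
     (Δ ((map d (range1 r) ++ d r ∷ map d (drop r (range1 n))) ++ replicate C (d n)) kstar ℤ.< + d n))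
proposition1 zero    d () _ _
proposition1 (suc K) d _ decreasing 1≤dn =
  (λ { (s≤s 1≤K) parity k⋆ 1≤k⋆ k⋆≤K maximal →
         PartA.result K d decreasing 1≤dn 1≤K k⋆ 1≤k⋆ k⋆≤K maximal parity }) ,
  -- The hypothesis that r is the last odd index is not needed: any odd term may be duplicated.
  (λ 2∤σ 2∣dn r 1≤r r≤n 2∤dr _ k⋆ 1≤k⋆ k⋆≤n maximal →
     PartB.result K d decreasing 1≤dn 2∤σ 2∣dn r 1≤r r≤n 2∤dr k⋆ 1≤k⋆ k⋆≤n maximal)
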